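{- Let $p$ be a prime number. If $p\equiv 1 \pmod 6$, then $$\sum_{k=0}^{(p-1)/6}\frac{1}{3k+1}\equiv -\frac{2}{3}q_{2}+2 \pmod p,\qquad \sum_{k=0}^{(p-1)/6}\frac{1}{3k+2}\equiv -\frac{2}{3}q_{2}+\frac{1}{2}q_{3}+\frac{2}{3} \pmod p,$$ and if $p\equiv 5 \pmod 6$, then $$\sum_{k=0}^{(p-5)/6}\frac{1}{3k+1}\equiv \frac{1}{2}q_{3}-\frac{2}{3}q_{2} \pmod p,\qquad \sum_{k=0}^{(p-5)/6}\frac{1}{3k+2}\equiv -\frac{2}{3}q_{2} \pmod p.$$
   Context: For a prime $p$ and an integer $a$ not divisible by $p$, $q_a=(a^{p-1}-1)/p$ is the Fermat quotient. Congruences between rational numbers are understood for rationals whose denominators are coprime to $p$. -}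

module Defs where

open import Data.Nat using (ℕ; zero; suc; _*_; _^_; _∸_)
open import Data.Nat.Divisibility using (_∣_)
open import Data.Integer using (+_; ∣_∣)
open import Data.Rational using (ℚ; _/_; _+_; _-_; ↥_; ↧ₙ_; 0ℚ)
open import Data.Product using (_×_)
open import Relation.Nullary using (¬_)

-- Σ_{k=0}^{n} f k  (inclusive upper bound)
sumTo : ℕ → (ℕ → ℚ) → ℚ
sumTo zero    f = f 0
sumTo (suc n) f = sumTo n f + f (suc n)

-- Fermat quotient q_a = (a^(p-1) - 1)/p  (as a rational; p = 0 never used since p prime)
fermatQ : ℕ → ℕ → ℚ
fermatQ a zero    = 0ℚ
fermatQ a (suc n) = (+ (a ^ n ∸ 1)) / suc n

-- x ≡ y (mod p) for rationals whose (reduced) denominators are coprime to p: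
-- both denominators are not divisible by p, and p divides the numerator of x - y.
_≡_[modℚ_] : ℚ → ℚ → ℕ → Set
x ≡ y [modℚ p ] = (¬ p ∣ ↧ₙ x) × (¬ p ∣ ↧ₙ y) × (p ∣ ∣ ↥ (x - y) ∣)

module Submission where

-- Lerch's formula q_a ≡ (1/a) Σ_{j=1}^{p-1} ⌊aj/p⌋/j (mod p) comes from multiplying the identities
-- aj = r_j + p⌊aj/p⌋ over j = 1, …, p - 1: the residues r_j permute 1, …, p - 1, so
-- a^(p-1) = Π (1 + p⌊aj/p⌋/r_j) ≡ 1 + p Σ ⌊aj/p⌋/r_j (mod p²), and r_j ≡ aj.
-- For a = 2, 3, 6 the floor ⌊aj/p⌋ only depends on the sextant ⌊6j/p⌋ of j. Together with
-- q_6 ≡ q_2 + q_3 and the reflection 1/j ≡ -1/(p - j), which exchanges sextants s and 5 - s, the three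
-- formulas determine the sums of 1/j over the first three sextants in terms of q_2 and q_3.
-- Reflecting 1/(3k + r) to -1/(p - 3k - r), where p - 3k - r is a multiple of 3, turns one of the two
-- sums of the theorem into such a sextant sum; splitting the harmonic sum up to about p/2 by residues
-- mod 3 gives the other, up to a few reciprocals of numbers near p/6 and p/2 evaluated directly.

open import Data.Nat as ℕ using (ℕ; zero; suc; _<_; _≤_; _∸_)
import Data.Nat
import Data.Nat.Properties as ℕ
import Data.Nat.Tactic.RingSolver as ℕ-Solver
open import Data.Nat.DivMod
  using (_%_; m≡m%n+[m/n]*n; m%n<n; m<n⇒m/n≡0; m*n/n≡m; +-distrib-/-∣ʳ; /-congˡ; m/n/o≡m/[n*o]; m*n/o*n≡m/o)
open import Data.Nat.Divisibility
  using (_∣_; divides; _∣0; >⇒∤; ∣m∣n⇒∣m+n; m∣m*n; n∣m*n; ∣1⇒≡1; ∣n⇒∣m*n; ∣m⇒∣m*n; ∣-refl)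
open import Data.Nat.Primality using (Prime; euclidsLemma; prime⇒nonTrivial)
import Data.Nat.Coprimality as Coprime
open import Data.Fin as Fin using (Fin; toℕ; fromℕ<)
import Data.Fin.Properties as Fin
open import Data.Integer as ℤ using (ℤ; +_)
import Data.Integer.Properties as ℤ
open import Data.Rational using (ℚ; mkℚ; _/_; _+_; _*_; -_; _-_; 0ℚ; 1ℚ; ↥_; ↧_; ↧ₙ_; toℚᵘ)
open import Data.Rational.Properties
  using ( toℚᵘ-injective; toℚᵘ-fromℚᵘ; toℚᵘ-homo-*; toℚᵘ-homo-+; toℚᵘ-homo‿-; +-*-commutativeRing; _≟_
        ; *-identityˡ; *-identityʳ; +-identityˡ; +-identityʳ; +-assoc; *-assoc; *-comm; *-zeroʳ; *-distribˡ-+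
        ; +-inverseʳ; neg-distribˡ-*; neg-distribʳ-* )
open import Data.Rational.Unnormalised as ℚᵘ using (mkℚᵘ; *≡*; _≃_)
import Data.Rational.Unnormalised.Properties as ℚᵘ
open import Data.Product using (∃; _×_; _,_; proj₁)
open import Data.Sum using (inj₁; inj₂)
open import Function using (_∘_; _∘′_)
open import Relation.Nullary using (¬_; yes; no; contradiction)
import Relation.Nullary.Decidable.Core as Dec
open import Relation.Binary.Bundles using (PartialSetoid)
open import Relation.Binary.Definitions using (tri<; tri≈; tri>)
open import Relation.Binary.PropositionalEquality
open import Tactic.RingSolver using (solve-∀)
open import Tactic.RingSolver.Core.AlmostCommutativeRing using (AlmostCommutativeRing; fromCommutativeRing)
open import Defs

ℚ-ring : AlmostCommutativeRing _ _
ℚ-ring = fromCommutativeRing +-*-commutativeRing (λ x → Dec.dec⇒maybe (0ℚ ≟ x))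

-- ι and recip are opaque so that the ring solver treats their values as atoms.
opaque
  ι : ℤ → ℚ
  ι n = n / 1

  ι-literal : ∀ n → ι n ≡ n / 1
  ι-literal n = refl

  ι-1 : ι (+ 1) ≡ 1ℚ
  ι-1 = refl

  toℚᵘ-ι : ∀ n → toℚᵘ (ι n) ≃ mkℚᵘ n 0
  toℚᵘ-ι n = toℚᵘ-fromℚᵘ (mkℚᵘ n 0)

ιₙ : ℕ → ℚ
ιₙ n = ι (+ n)

ι-homo-+ : ∀ m n → ι (m ℤ.+ n) ≡ ι m + ι n
ι-homo-+ m n = toℚᵘ-injective (ℚᵘ.≃-trans (toℚᵘ-ι (m ℤ.+ n))
  (ℚᵘ.≃-sym (ℚᵘ.≃-trans (toℚᵘ-homo-+ (ι m) (ι n))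
    (ℚᵘ.≃-trans (ℚᵘ.+-cong (toℚᵘ-ι m) (toℚᵘ-ι n)) (*≡* eq)))))
  where
  eq : (m ℤ.* + 1 ℤ.+ n ℤ.* + 1) ℤ.* + 1 ≡ (m ℤ.+ n) ℤ.* + 1
  eq = trans (ℤ.*-identityʳ _)
    (trans (cong₂ ℤ._+_ (ℤ.*-identityʳ m) (ℤ.*-identityʳ n)) (sym (ℤ.*-identityʳ (m ℤ.+ n))))

ι-homo-* : ∀ m n → ι (m ℤ.* n) ≡ ι m * ι n
ι-homo-* m n = toℚᵘ-injective (ℚᵘ.≃-trans (toℚᵘ-ι (m ℤ.* n))
  (ℚᵘ.≃-sym (ℚᵘ.≃-trans (toℚᵘ-homo-* (ι m) (ι n))
    (ℚᵘ.≃-trans (ℚᵘ.*-cong (toℚᵘ-ι m) (toℚᵘ-ι n)) (*≡* refl)))))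

ι-homo‿- : ∀ m → ι (ℤ.- m) ≡ - ι m
ι-homo‿- m = toℚᵘ-injective (ℚᵘ.≃-trans (toℚᵘ-ι (ℤ.- m))
  (ℚᵘ.≃-sym (ℚᵘ.≃-trans (toℚᵘ-homo‿- (ι m)) (ℚᵘ.-‿cong (toℚᵘ-ι m)))))

ιₙ-homo-+ : ∀ m n → ιₙ (m ℕ.+ n) ≡ ιₙ m + ιₙ n
ιₙ-homo-+ m n = trans (cong ι (ℤ.pos-+ m n)) (ι-homo-+ (+ m) (+ n))

ιₙ-homo-* : ∀ m n → ιₙ (m ℕ.* n) ≡ ιₙ m * ιₙ n
ιₙ-homo-* m n = trans (cong ι (ℤ.pos-* m n)) (ι-homo-* (+ m) (+ n))

x*d≡n⇒↥x*d≡n*↧x : ∀ x n d → x * ιₙ d ≡ ι n → ↥ x ℤ.* + d ≡ n ℤ.* ↧ x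
x*d≡n⇒↥x*d≡n*↧x x@(mkℚ a b _) n d eq
  with ℚᵘ.≃-trans (ℚᵘ.≃-sym (ℚᵘ.*-congˡ {mkℚᵘ a b} (toℚᵘ-ι (+ d))))
         (ℚᵘ.≃-trans (ℚᵘ.≃-sym (toℚᵘ-homo-* x (ι (+ d))))
           (ℚᵘ.≃-trans (ℚᵘ.≃-reflexive (cong toℚᵘ eq)) (toℚᵘ-ι n)))
... | *≡* e = trans (sym (ℤ.*-identityʳ _)) (trans e (cong (λ z → n ℤ.* + z) (ℕ.*-identityʳ (suc b))))

n/d*d≡n : ∀ n d .{{_ : ℕ.NonZero d}} → (n / d) * ιₙ d ≡ ι n
n/d*d≡n n (suc d) = toℚᵘ-injective (ℚᵘ.≃-trans (toℚᵘ-homo-* (n / suc d) (ι (+ suc d)))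
  (ℚᵘ.≃-trans (ℚᵘ.*-cong (toℚᵘ-fromℚᵘ (mkℚᵘ n d)) (toℚᵘ-ι (+ suc d)))
  (ℚᵘ.≃-trans (*≡* eq) (ℚᵘ.≃-sym (toℚᵘ-ι n)))))
  where
  eq : n ℤ.* + suc d ℤ.* + 1 ≡ n ℤ.* + (suc d ℕ.* 1)
  eq = trans (ℤ.*-identityʳ _) (cong (λ z → n ℤ.* + z) (sym (ℕ.*-identityʳ (suc d))))

-- recip 0 = 0 is a junk value; every use below has a nonzero argument.
opaque
  recip : ℕ → ℚ
  recip zero    = 0ℚ
  recip (suc n) = + 1 / suc n

  recip-literal : ∀ n .{{_ : ℕ.NonZero n}} → recip n ≡ + 1 / n
  recip-literal (suc n) = refl

  recip-inverseˡ : ∀ n .{{_ : ℕ.NonZero n}} → recip n * ιₙ n ≡ 1ℚ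
  recip-inverseˡ (suc n) = trans (n/d*d≡n (+ 1) (suc n)) ι-1

recip-unique : ∀ x n .{{_ : ℕ.NonZero n}} → x * ιₙ n ≡ 1ℚ → x ≡ recip n
recip-unique x n x*n≡1 = begin
  x                     ≡⟨ *-identityʳ x ⟨
  x * 1ℚ                ≡⟨ cong (x *_) (recip-inverseˡ n) ⟨
  x * (recip n * ιₙ n)  ≡⟨ x*[y*z]≡y*[x*z] x (recip n) (ιₙ n) ⟩
  recip n * (x * ιₙ n)  ≡⟨ cong (recip n *_) x*n≡1 ⟩
  recip n * 1ℚ          ≡⟨ *-identityʳ (recip n) ⟩
  recip n               ∎
  where
  open ≡-Reasoning

  x*[y*z]≡y*[x*z] : ∀ x y z → x * (y * z) ≡ y * (x * z)
  x*[y*z]≡y*[x*z] = solve-∀ ℚ-ring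

recip-homo-* : ∀ m n .{{_ : ℕ.NonZero m}} .{{_ : ℕ.NonZero n}} →
               recip (m ℕ.* n) ≡ recip m * recip n
recip-homo-* m n = sym (recip-unique (recip m * recip n) (m ℕ.* n) {{ℕ.m*n≢0 m n}} (begin
  recip m * recip n * ιₙ (m ℕ.* n)     ≡⟨ cong (recip m * recip n *_) (ιₙ-homo-* m n) ⟩
  recip m * recip n * (ιₙ m * ιₙ n)    ≡⟨ interchange (recip m) (recip n) (ιₙ m) (ιₙ n) ⟩
  (recip m * ιₙ m) * (recip n * ιₙ n)  ≡⟨ cong₂ _*_ (recip-inverseˡ m) (recip-inverseˡ n) ⟩
  1ℚ * 1ℚ                              ≡⟨⟩
  1ℚ                                   ∎))
  where
  open ≡-Reasoning

  interchange : ∀ a b c d → a * b * (c * d) ≡ (a * c) * (b * d)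
  interchange = solve-∀ ℚ-ring

ιₙ-*-recip : ∀ c e .{{_ : ℕ.NonZero e}} → ιₙ c * recip e ≡ (+ c / 1) * (+ 1 / e)
ιₙ-*-recip c e = cong₂ _*_ (ι-literal (+ c)) (recip-literal e)

∑ : ℕ → (ℕ → ℚ) → ℚ
∑ zero    f = 0ℚ
∑ (suc n) f = ∑ n f + f n

∏ : ℕ → (ℕ → ℚ) → ℚ
∏ zero    f = 1ℚ
∏ (suc n) f = ∏ n f * f n

∑-cong : ∀ n {f g} → (∀ i → i < n → f i ≡ g i) → ∑ n f ≡ ∑ n g
∑-cong zero    f≡g = refl
∑-cong (suc n) f≡g = cong₂ _+_ (∑-cong n (λ i i<n → f≡g i (ℕ.m<n⇒m<1+n i<n))) (f≡g n ℕ.≤-refl)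

∏-cong : ∀ n {f g} → (∀ i → i < n → f i ≡ g i) → ∏ n f ≡ ∏ n g
∏-cong zero    f≡g = refl
∏-cong (suc n) f≡g = cong₂ _*_ (∏-cong n (λ i i<n → f≡g i (ℕ.m<n⇒m<1+n i<n))) (f≡g n ℕ.≤-refl)

∑-+ : ∀ m n f → ∑ (m ℕ.+ n) f ≡ ∑ m f + ∑ n (λ i → f (m ℕ.+ i))
∑-+ m zero    f = trans (cong (λ k → ∑ k f) (ℕ.+-identityʳ m)) (sym (+-identityʳ (∑ m f)))
∑-+ m (suc n) f = begin
  ∑ (m ℕ.+ suc n) f                              ≡⟨ cong (λ k → ∑ k f) (ℕ.+-suc m n) ⟩
  ∑ (m ℕ.+ n) f + f (m ℕ.+ n)                    ≡⟨ cong (_+ f (m ℕ.+ n)) (∑-+ m n f) ⟩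
  ∑ m f + ∑ n (λ i → f (m ℕ.+ i)) + f (m ℕ.+ n)  ≡⟨ +-assoc (∑ m f) _ _ ⟩
  ∑ m f + ∑ (suc n) (λ i → f (m ℕ.+ i))          ∎
  where open ≡-Reasoning

∑-suc : ∀ n f → ∑ (suc n) f ≡ f 0 + ∑ n (λ i → f (suc i))
∑-suc zero    f = trans (+-identityˡ (f 0)) (sym (+-identityʳ (f 0)))
∑-suc (suc n) f = trans (cong (_+ f (suc n)) (∑-suc n f)) (+-assoc (f 0) _ _)

∑-*ˡ : ∀ n c f → ∑ n (λ i → c * f i) ≡ c * ∑ n f
∑-*ˡ zero    c f = sym (*-zeroʳ c)
∑-*ˡ (suc n) c f = trans (cong (_+ c * f n) (∑-*ˡ n c f)) (sym (*-distribˡ-+ c (∑ n f) (f n)))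

∏-* : ∀ n f g → ∏ n (λ i → f i * g i) ≡ ∏ n f * ∏ n g
∏-* zero    f g = refl
∏-* (suc n) f g = trans (cong (_* (f n * g n)) (∏-* n f g)) (interchange (∏ n f) (∏ n g) (f n) (g n))
  where
  interchange : ∀ a b c d → a * b * (c * d) ≡ (a * c) * (b * d)
  interchange = solve-∀ ℚ-ring

∏-ιₙ-const : ∀ n c → ∏ n (λ _ → ιₙ c) ≡ ιₙ (c ℕ.^ n)
∏-ιₙ-const zero    c = sym ι-1
∏-ιₙ-const (suc n) c = begin
  ∏ n (λ _ → ιₙ c) * ιₙ c  ≡⟨ cong (_* ιₙ c) (∏-ιₙ-const n c) ⟩
  ιₙ (c ℕ.^ n) * ιₙ c      ≡⟨ ιₙ-homo-* (c ℕ.^ n) c ⟨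
  ιₙ (c ℕ.^ n ℕ.* c)       ≡⟨ cong ιₙ (ℕ.*-comm (c ℕ.^ n) c) ⟩
  ιₙ (c ℕ.^ suc n)         ∎
  where open ≡-Reasoning

offset : (ℕ → ℕ) → ℕ → ℕ
offset ℓ zero    = 0
offset ℓ (suc s) = offset ℓ s ℕ.+ ℓ s

offset-const : ∀ c s → offset (λ _ → c) s ≡ s ℕ.* c
offset-const c zero    = refl
offset-const c (suc s) = trans (cong (ℕ._+ c) (offset-const c s)) (ℕ.+-comm (s ℕ.* c) c)

∑-blocks : ∀ ℓ k (f : ℕ → ℚ) →
           ∑ (offset ℓ k) f ≡ ∑ k (λ s → ∑ (ℓ s) (λ i → f (offset ℓ s ℕ.+ i)))
∑-blocks ℓ zero    f = refl
∑-blocks ℓ (suc k) f =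
  trans (∑-+ (offset ℓ k) (ℓ k) f) (cong (_+ ∑ (ℓ k) (λ i → f (offset ℓ k ℕ.+ i))) (∑-blocks ℓ k f))

≤-witness : ∀ {x y} w → x ℕ.+ w ≡ y → x ℕ.≤ y
≤-witness {x} w refl = ℕ.m≤m+n x w

<-witness : ∀ {x y} w → suc (x ℕ.+ w) ≡ y → x < y
<-witness {x} w refl = ℕ.s≤s (ℕ.m≤m+n x w)

<3-cases : ∀ {a} {P : ℕ → Set a} → P 0 → P 1 → P 2 → ∀ s → s < 3 → P s
<3-cases p₀ p₁ p₂ 0 _ = p₀
<3-cases p₀ p₁ p₂ 1 _ = p₁
<3-cases p₀ p₁ p₂ 2 _ = p₂
<3-cases p₀ p₁ p₂ (suc (suc (suc _))) (ℕ.s≤s (ℕ.s≤s (ℕ.s≤s ())))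

<6-cases : ∀ {a} {P : ℕ → Set a} → P 0 → P 1 → P 2 → P 3 → P 4 → P 5 → ∀ s → s < 6 → P s
<6-cases p₀ p₁ p₂ p₃ p₄ p₅ 0 _ = p₀
<6-cases p₀ p₁ p₂ p₃ p₄ p₅ 1 _ = p₁
<6-cases p₀ p₁ p₂ p₃ p₄ p₅ 2 _ = p₂
<6-cases p₀ p₁ p₂ p₃ p₄ p₅ 3 _ = p₃
<6-cases p₀ p₁ p₂ p₃ p₄ p₅ 4 _ = p₄
<6-cases p₀ p₁ p₂ p₃ p₄ p₅ 5 _ = p₅
<6-cases p₀ p₁ p₂ p₃ p₄ p₅ (suc (suc (suc (suc (suc (suc _))))))
         (ℕ.s≤s (ℕ.s≤s (ℕ.s≤s (ℕ.s≤s (ℕ.s≤s (ℕ.s≤s ()))))))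

MapsInto : ℕ → (ℕ → ℕ) → Set
MapsInto n g = ∀ {i} → i < n → g i < n

InjectiveOn : ℕ → (ℕ → ℕ) → Set
InjectiveOn n g = ∀ {i j} → i < n → j < n → g i ≡ g j → i ≡ j

injective⇒hits-max : ∀ n g → MapsInto (suc n) g → InjectiveOn (suc n) g →
                     ∃ λ i → i < suc n × g i ≡ n
injective⇒hits-max n g g< g-inj with Fin.any? (λ (i : Fin (suc n)) → g (toℕ i) ℕ.≟ n)
... | yes (i , gi≡n) = toℕ i , Fin.toℕ<n i , gi≡n
... | no  misses     = contradiction (Fin.pigeonhole ℕ.≤-refl g′) no-collision
  where
  g<n : ∀ i → g (toℕ i) < n
  g<n i = ℕ.≤∧≢⇒< (ℕ.s≤s⁻¹ (g< (Fin.toℕ<n i))) (λ gi≡n → misses (i , gi≡n))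

  g′ : Fin (suc n) → Fin n
  g′ i = fromℕ< (g<n i)

  no-collision : ¬ ∃ λ i → ∃ λ j → i Fin.< j × g′ i ≡ g′ j
  no-collision (i , j , i<j , g′i≡g′j) = ℕ.<⇒≢ i<j (g-inj (Fin.toℕ<n i) (Fin.toℕ<n j)
    (trans (sym (Fin.toℕ-fromℕ< (g<n i))) (trans (cong toℕ g′i≡g′j) (Fin.toℕ-fromℕ< (g<n j)))))

update : (ℕ → ℕ) → ℕ → ℕ → ℕ → ℕ
update g i₀ y i with i ℕ.≟ i₀
... | yes _ = y
... | no  _ = g i

update-≢ : ∀ g {i₀} y {i} → i ≢ i₀ → update g i₀ y i ≡ g i
update-≢ g {i₀} y {i} i≢i₀ with i ℕ.≟ i₀
... | yes i≡i₀ = contradiction i≡i₀ i≢i₀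
... | no  _    = refl

update-≡ : ∀ g i₀ y → update g i₀ y i₀ ≡ y
update-≡ g i₀ y with i₀ ℕ.≟ i₀
... | yes _   = refl
... | no  i≢i = contradiction refl i≢i

-- Moving the value g n into position i₀ turns an injection of [0, n+1) that sends
-- i₀ to n into an injection of [0, n) into itself.
module Shrink (n : ℕ) (g : ℕ → ℕ) (g< : MapsInto (suc n) g) (g-inj : InjectiveOn (suc n) g)
              (i₀ : ℕ) (i₀<1+n : i₀ < suc n) (gi₀≡n : g i₀ ≡ n) where

  h : ℕ → ℕ
  h = update g i₀ (g n)

  g≢n : ∀ {i} → i < suc n → i ≢ i₀ → g i ≢ n
  g≢n i<1+n i≢i₀ gi≡n = i≢i₀ (g-inj i<1+n i₀<1+n (trans gi≡n (sym gi₀≡n)))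

  h< : MapsInto n h
  h< {i} i<n with i ℕ.≟ i₀
  ... | yes refl = ℕ.≤∧≢⇒< (ℕ.s≤s⁻¹ (g< ℕ.≤-refl)) (g≢n ℕ.≤-refl (λ n≡i → ℕ.<⇒≢ i<n (sym n≡i)))
  ... | no  i≢i₀ = ℕ.≤∧≢⇒< (ℕ.s≤s⁻¹ (g< (ℕ.m<n⇒m<1+n i<n))) (g≢n (ℕ.m<n⇒m<1+n i<n) i≢i₀)

  h-inj : InjectiveOn n h
  h-inj {i} {j} i<n j<n hi≡hj with i ℕ.≟ i₀ | j ℕ.≟ i₀
  ... | yes i≡i₀ | yes j≡i₀ = trans i≡i₀ (sym j≡i₀)
  ... | yes _    | no  _    = contradiction (g-inj ℕ.≤-refl (ℕ.m<n⇒m<1+n j<n) hi≡hj) (ℕ.<⇒≢ j<n ∘′ sym)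
  ... | no  _    | yes _    = contradiction (g-inj (ℕ.m<n⇒m<1+n i<n) ℕ.≤-refl hi≡hj) (ℕ.<⇒≢ i<n)
  ... | no  _    | no  _    = g-inj (ℕ.m<n⇒m<1+n i<n) (ℕ.m<n⇒m<1+n j<n) hi≡hj

private
  swap-last : ∀ a b c → a * b * c ≡ a * c * b
  swap-last a b c = trans (*-assoc a b c) (trans (cong (a *_) (*-comm b c)) (sym (*-assoc a c b)))

∏-update : ∀ n (f : ℕ → ℚ) g y {i₀} → i₀ < n →
           ∏ n (λ i → f (g i)) * f y ≡ ∏ n (λ i → f (update g i₀ y i)) * f (g i₀)
∏-update (suc n) f g y {i₀} i₀<1+n with ℕ.m<1+n⇒m<n∨m≡n i₀<1+n
... | inj₂ refl = begin
  ∏ n (f ∘′ g) * f (g n) * f y        ≡⟨ swap-last (∏ n (f ∘′ g)) (f (g n)) (f y) ⟩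
  ∏ n (f ∘′ g) * f y * f (g n)        ≡⟨ cong (λ z → z * f y * f (g n)) (∏-cong n agree) ⟩
  ∏ n (f ∘′ g′) * f y * f (g n)       ≡⟨ cong (λ z → ∏ n (f ∘′ g′) * f z * f (g n)) (update-≡ g n y) ⟨
  ∏ n (f ∘′ g′) * f (g′ n) * f (g n)  ∎
  where
  open ≡-Reasoning

  g′ : ℕ → ℕ
  g′ = update g n y
  agree : ∀ i → i < n → f (g i) ≡ f (g′ i)
  agree i i<n = cong f (sym (update-≢ g y (ℕ.<⇒≢ i<n)))
... | inj₁ i₀<n = begin
  ∏ n (f ∘′ g) * f (g n) * f y         ≡⟨ swap-last (∏ n (f ∘′ g)) (f (g n)) (f y) ⟩
  ∏ n (f ∘′ g) * f y * f (g n)         ≡⟨ cong (_* f (g n)) (∏-update n f g y i₀<n) ⟩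
  ∏ n (f ∘′ g′) * f (g i₀) * f (g n)   ≡⟨ swap-last (∏ n (f ∘′ g′)) (f (g i₀)) (f (g n)) ⟩
  ∏ n (f ∘′ g′) * f (g n) * f (g i₀)   ≡⟨ cong (λ z → ∏ n (f ∘′ g′) * f z * f (g i₀)) n≢i₀ ⟨
  ∏ n (f ∘′ g′) * f (g′ n) * f (g i₀)  ∎
  where
  open ≡-Reasoning

  g′ : ℕ → ℕ
  g′ = update g i₀ y
  n≢i₀ : g′ n ≡ g n
  n≢i₀ = update-≢ g y (ℕ.<⇒≢ i₀<n ∘′ sym)

∏-extract : ∀ n (f : ℕ → ℚ) g {i₀} → i₀ < suc n →
            ∏ (suc n) (λ i → f (g i)) ≡ ∏ n (λ i → f (update g i₀ (g n) i)) * f (g i₀)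
∏-extract n f g {i₀} i₀<1+n with ℕ.m<1+n⇒m<n∨m≡n i₀<1+n
... | inj₁ i₀<n = ∏-update n f g (g n) i₀<n
... | inj₂ refl = cong (_* f (g n)) (∏-cong n (λ i i<n → cong f (sym (update-≢ g (g n) (ℕ.<⇒≢ i<n)))))

∏-permute : ∀ n (f : ℕ → ℚ) g → MapsInto n g → InjectiveOn n g → ∏ n (λ i → f (g i)) ≡ ∏ n f
∏-permute zero    f g g< g-inj = refl
∏-permute (suc n) f g g< g-inj with injective⇒hits-max n g g< g-inj
... | i₀ , i₀<1+n , gi₀≡n = begin
  ∏ (suc n) (f ∘′ g)       ≡⟨ ∏-extract n f g i₀<1+n ⟩
  ∏ n (f ∘′ h) * f (g i₀)  ≡⟨ cong₂ _*_ (∏-permute n f h h< h-inj) (cong f gi₀≡n) ⟩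
  ∏ n f * f n              ∎
  where
  open ≡-Reasoning
  open Shrink n g g< g-inj i₀ i₀<1+n gi₀≡n

module Congruence (p : ℕ) (p-prime : Prime p) where

  p∤1 : ¬ p ∣ 1
  p∤1 p∣1 = ℕ.nonTrivial⇒≢1 {{prime⇒nonTrivial p-prime}} (∣1⇒≡1 p∣1)

  p∤* : ∀ {m n} → ¬ p ∣ m → ¬ p ∣ n → ¬ p ∣ m ℕ.* n
  p∤* {m} {n} p∤m p∤n p∣mn with euclidsLemma m n p-prime p∣mn
  ... | inj₁ p∣m = p∤m p∣m
  ... | inj₂ p∣n = p∤n p∣n

  p∤⇒nonZero : ∀ {n} → ¬ p ∣ n → ℕ.NonZero n
  p∤⇒nonZero {zero}  p∤0 = contradiction (p ∣0) p∤0
  p∤⇒nonZero {suc n} _   = _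

  0<j<p⇒p∤j : ∀ {j} → 0 < j → j < p → ¬ p ∣ j
  0<j<p⇒p∤j {suc j} _ j<p = >⇒∤ j<p

  x+y≡p⇒p∤x : ∀ {x y} → x ℕ.+ y ≡ p → 0 < x → 0 < y → ¬ p ∣ x
  x+y≡p⇒p∤x {x} {suc y} x+y≡p 0<x _ = 0<j<p⇒p∤j 0<x (subst (x <_) x+y≡p (ℕ.m<m+n x ℕ.z<s))

  record Integral (x : ℚ) : Set where
    constructor integral
    field
      numerator     : ℤ
      denominator   : ℕ
      p∤denominator : ¬ p ∣ denominator
      clears        : x * ιₙ denominator ≡ ι numerator

  Divisible : ℚ → Set
  Divisible x = ∃ λ y → Integral y × x ≡ ιₙ p * y

  Integral-ι : ∀ n → Integral (ι n)
  Integral-ι n = integral n 1 p∤1 (trans (cong (ι n *_) ι-1) (*-identityʳ (ι n)))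

  Integral-/ : ∀ n d .{{_ : ℕ.NonZero d}} → ¬ p ∣ d → Integral (n / d)
  Integral-/ n d p∤d = integral n d p∤d (n/d*d≡n n d)

  Integral-recip : ∀ {n} → ¬ p ∣ n → Integral (recip n)
  Integral-recip {n} p∤n = integral (+ 1) n p∤n (trans (recip-inverseˡ n {{p∤⇒nonZero p∤n}}) (sym ι-1))

  Integral-+ : ∀ {x y} → Integral x → Integral y → Integral (x + y)
  Integral-+ {x} {y} (integral m d p∤d xd≡m) (integral n e p∤e ye≡n) =
    integral (m ℤ.* + e ℤ.+ n ℤ.* + d) (d ℕ.* e) (p∤* p∤d p∤e) (begin
      (x + y) * ιₙ (d ℕ.* e)             ≡⟨ cong ((x + y) *_) (ιₙ-homo-* d e) ⟩
      (x + y) * (ιₙ d * ιₙ e)            ≡⟨ expand x y (ιₙ d) (ιₙ e) ⟩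
      x * ιₙ d * ιₙ e + y * ιₙ e * ιₙ d  ≡⟨ cong₂ (λ u v → u * ιₙ e + v * ιₙ d) xd≡m ye≡n ⟩
      ι m * ιₙ e + ι n * ιₙ d            ≡⟨ cong₂ _+_ (ι-homo-* m (+ e)) (ι-homo-* n (+ d)) ⟨
      ι (m ℤ.* + e) + ι (n ℤ.* + d)      ≡⟨ ι-homo-+ (m ℤ.* + e) (n ℤ.* + d) ⟨
      ι (m ℤ.* + e ℤ.+ n ℤ.* + d)        ∎)
    where
    open ≡-Reasoning
    expand : ∀ x y a b → (x + y) * (a * b) ≡ x * a * b + y * b * a
    expand = solve-∀ ℚ-ring

  Integral-* : ∀ {x y} → Integral x → Integral y → Integral (x * y)
  Integral-* {x} {y} (integral m d p∤d xd≡m) (integral n e p∤e ye≡n) =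
    integral (m ℤ.* n) (d ℕ.* e) (p∤* p∤d p∤e) (begin
      (x * y) * ιₙ (d ℕ.* e)   ≡⟨ cong ((x * y) *_) (ιₙ-homo-* d e) ⟩
      (x * y) * (ιₙ d * ιₙ e)  ≡⟨ interchange x y (ιₙ d) (ιₙ e) ⟩
      (x * ιₙ d) * (y * ιₙ e)  ≡⟨ cong₂ _*_ xd≡m ye≡n ⟩
      ι m * ι n                ≡⟨ ι-homo-* m n ⟨
      ι (m ℤ.* n)              ∎)
    where
    open ≡-Reasoning
    interchange : ∀ x y a b → (x * y) * (a * b) ≡ (x * a) * (y * b)
    interchange = solve-∀ ℚ-ring

  Integral-neg : ∀ {x} → Integral x → Integral (- x)
  Integral-neg {x} (integral n d p∤d xd≡n) =
    integral (ℤ.- n) d p∤d (trans (sym (neg-distribˡ-* x (ιₙ d))) (trans (cong -_ xd≡n) (sym (ι-homo‿- n))))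

  Integral-0 : Integral 0ℚ
  Integral-0 = Integral-/ (+ 0) 1 p∤1

  Integral-∑ : ∀ n {f} → (∀ i → i < n → Integral (f i)) → Integral (∑ n f)
  Integral-∑ zero    f-int = Integral-0
  Integral-∑ (suc n) f-int =
    Integral-+ (Integral-∑ n (λ i i<n → f-int i (ℕ.m<n⇒m<1+n i<n))) (f-int n ℕ.≤-refl)

  Divisible-+ : ∀ {x y} → Divisible x → Divisible y → Divisible (x + y)
  Divisible-+ (u , u-int , refl) (v , v-int , refl) =
    u + v , Integral-+ u-int v-int , sym (*-distribˡ-+ (ιₙ p) u v)

  Divisible-*ʳ : ∀ {x y} → Divisible x → Integral y → Divisible (x * y)
  Divisible-*ʳ {y = y} (u , u-int , refl) y-int = u * y , Integral-* u-int y-int , *-assoc (ιₙ p) u y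

  Divisible-neg : ∀ {x} → Divisible x → Divisible (- x)
  Divisible-neg (u , u-int , refl) = - u , Integral-neg u-int , neg-distribʳ-* (ιₙ p) u

  Divisible-0 : Divisible 0ℚ
  Divisible-0 = 0ℚ , Integral-0 , sym (*-zeroʳ (ιₙ p))

  Divisible-p* : ∀ {x} → Integral x → Divisible (ιₙ p * x)
  Divisible-p* x-int = _ , x-int , refl

  Divisible⇒Integral : ∀ {x} → Divisible x → Integral x
  Divisible⇒Integral (u , u-int , refl) = Integral-* (Integral-ι (+ p)) u-int

  Divisible-≡ : ∀ {x y} → x ≡ y → Divisible x → Divisible y
  Divisible-≡ refl x-div = x-div

  Integral⇒p∤denominator : ∀ {x} → Integral x → ¬ p ∣ ↧ₙ x
  Integral⇒p∤denominator {x@(mkℚ a b coprime)} (integral n d p∤d xd≡n) p∣b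
    with euclidsLemma ℤ.∣ a ∣ d p-prime (subst (p ∣_) (sym |a|d≡|n|b) (∣n⇒∣m*n ℤ.∣ n ∣ p∣b))
    where
    |a|d≡|n|b : ℤ.∣ a ∣ ℕ.* d ≡ ℤ.∣ n ∣ ℕ.* suc b
    |a|d≡|n|b = trans (sym (ℤ.abs-* a (+ d)))
      (trans (cong ℤ.∣_∣ (x*d≡n⇒↥x*d≡n*↧x x n d xd≡n)) (ℤ.abs-* n (+ suc b)))
  ... | inj₁ p∣a = p∤1 (subst (p ∣_) (Coprime.recompute coprime (p∣a , p∣b)) ∣-refl)
  ... | inj₂ p∣d = p∤d p∣d

  Divisible⇒p∣numerator : ∀ {x} → Divisible x → p ∣ ℤ.∣ ↥ x ∣
  Divisible⇒p∣numerator {x@(mkℚ a b _)} (u , integral n d p∤d ud≡n , x≡pu)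
    with euclidsLemma ℤ.∣ a ∣ d p-prime
           (subst (p ∣_) (sym |a|d≡p|n|b) (∣m⇒∣m*n (suc b) (∣m⇒∣m*n ℤ.∣ n ∣ ∣-refl)))
    where
    xd≡pn : x * ιₙ d ≡ ι (+ p ℤ.* n)
    xd≡pn = begin
      x * ιₙ d           ≡⟨ cong (_* ιₙ d) x≡pu ⟩
      ιₙ p * u * ιₙ d    ≡⟨ *-assoc (ιₙ p) u (ιₙ d) ⟩
      ιₙ p * (u * ιₙ d)  ≡⟨ cong (ιₙ p *_) ud≡n ⟩
      ιₙ p * ι n         ≡⟨ ι-homo-* (+ p) n ⟨
      ι (+ p ℤ.* n)      ∎
      where open ≡-Reasoning
    |a|d≡p|n|b : ℤ.∣ a ∣ ℕ.* d ≡ p ℕ.* ℤ.∣ n ∣ ℕ.* suc b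
    |a|d≡p|n|b = trans (sym (ℤ.abs-* a (+ d)))
      (trans (cong ℤ.∣_∣ (x*d≡n⇒↥x*d≡n*↧x x (+ p ℤ.* n) d xd≡pn))
      (trans (ℤ.abs-* (+ p ℤ.* n) (+ suc b)) (cong (ℕ._* suc b) (ℤ.abs-* (+ p) n))))
  ... | inj₁ p∣a = p∣a
  ... | inj₂ p∣d = contradiction p∣d p∤d

  infix 4 _≈_
  _≈_ : ℚ → ℚ → Set
  x ≈ y = Integral x × Integral y × Divisible (x - y)

  ≈⇒≡[modℚ] : ∀ {x y} → x ≈ y → x ≡ y [modℚ p ]
  ≈⇒≡[modℚ] (x-int , y-int , x-y-div) =
    Integral⇒p∤denominator x-int , Integral⇒p∤denominator y-int , Divisible⇒p∣numerator x-y-div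

  ≈-refl : ∀ {x} → Integral x → x ≈ x
  ≈-refl {x} x-int = x-int , x-int , Divisible-≡ (sym (+-inverseʳ x)) Divisible-0

  ≈-reflexive : ∀ {x y} → x ≡ y → Integral x → x ≈ y
  ≈-reflexive refl = ≈-refl

  ≈-respˡ-≡ : ∀ {x y z} → x ≡ y → y ≈ z → x ≈ z
  ≈-respˡ-≡ refl y≈z = y≈z

  ≈-sym : ∀ {x y} → x ≈ y → y ≈ x
  ≈-sym {x} {y} (x-int , y-int , x-y-div) = y-int , x-int , Divisible-≡ (neg-sub x y) (Divisible-neg x-y-div)
    where
    neg-sub : ∀ x y → - (x - y) ≡ y - x
    neg-sub = solve-∀ ℚ-ring

  ≈-trans : ∀ {x y z} → x ≈ y → y ≈ z → x ≈ z
  ≈-trans {x} {y} {z} (x-int , _ , x-y-div) (_ , z-int , y-z-div) =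
    x-int , z-int , Divisible-≡ (telescope x y z) (Divisible-+ x-y-div y-z-div)
    where
    telescope : ∀ x y z → (x - y) + (y - z) ≡ x - z
    telescope = solve-∀ ℚ-ring

  ≈-partialSetoid : PartialSetoid _ _
  ≈-partialSetoid = record
    { _≈_ = _≈_
    ; isPartialEquivalence = record { sym = ≈-sym ; trans = ≈-trans }
    }

  module ≈-Reasoning where
    open import Relation.Binary.Reasoning.PartialSetoid ≈-partialSetoid public

  ≈-fromDivisible : ∀ {x y} → Integral y → Divisible (x - y) → x ≈ y
  ≈-fromDivisible {x} {y} y-int x-y-div =
    subst Integral (y+[x-y]≡x y x) (Integral-+ y-int (Divisible⇒Integral x-y-div)) , y-int , x-y-div
    where
    y+[x-y]≡x : ∀ y x → y + (x - y) ≡ x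
    y+[x-y]≡x = solve-∀ ℚ-ring

  ≈-+ : ∀ {x y u v} → x ≈ y → u ≈ v → x + u ≈ y + v
  ≈-+ {x} {y} {u} {v} (x-int , y-int , x-y-div) (u-int , v-int , u-v-div) =
    Integral-+ x-int u-int , Integral-+ y-int v-int ,
    Divisible-≡ (regroup x y u v) (Divisible-+ x-y-div u-v-div)
    where
    regroup : ∀ x y u v → (x - y) + (u - v) ≡ (x + u) - (y + v)
    regroup = solve-∀ ℚ-ring

  ≈-* : ∀ {x y u v} → x ≈ y → u ≈ v → x * u ≈ y * v
  ≈-* {x} {y} {u} {v} (x-int , y-int , x-y-div) (u-int , v-int , u-v-div) =
    Integral-* x-int u-int , Integral-* y-int v-int ,
    Divisible-≡ (regroup x y u v) (Divisible-+ (Divisible-*ʳ x-y-div u-int) (Divisible-*ʳ u-v-div y-int))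
    where
    regroup : ∀ x y u v → (x - y) * u + (u - v) * y ≡ x * u - y * v
    regroup = solve-∀ ℚ-ring

  ≈-neg : ∀ {x y} → x ≈ y → - x ≈ - y
  ≈-neg {x} {y} (x-int , y-int , x-y-div) =
    Integral-neg x-int , Integral-neg y-int , Divisible-≡ (regroup x y) (Divisible-neg x-y-div)
    where
    regroup : ∀ x y → - (x - y) ≡ (- x) - (- y)
    regroup = solve-∀ ℚ-ring

  ≈-- : ∀ {x y u v} → x ≈ y → u ≈ v → x - u ≈ y - v
  ≈-- x≈y u≈v = ≈-+ x≈y (≈-neg u≈v)

  ≈-*ˡ : ∀ {c x y} → Integral c → x ≈ y → c * x ≈ c * y
  ≈-*ˡ c-int = ≈-* (≈-refl c-int)

  recip≈/ : ∀ n .{{_ : ℕ.NonZero n}} → ¬ p ∣ n → recip n ≈ + 1 / n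
  recip≈/ n p∤n = ≈-reflexive (recip-literal n) (Integral-recip p∤n)

  ≈-∑ : ∀ n {f g} → (∀ i → i < n → f i ≈ g i) → ∑ n f ≈ ∑ n g
  ≈-∑ zero    f≈g = ≈-refl Integral-0
  ≈-∑ (suc n) f≈g = ≈-+ (≈-∑ n (λ i i<n → f≈g i (ℕ.m<n⇒m<1+n i<n))) (f≈g n ℕ.≤-refl)

  infixl 6 _⊕_
  infix  7 _⊙_

  _⊙_ : ∀ {c u v} → Integral c → u ≈ v → Divisible (c * (u - v))
  _⊙_ {c} {u} {v} c-int (_ , _ , u-v-div) = Divisible-≡ (*-comm (u - v) c) (Divisible-*ʳ u-v-div c-int)

  _⊕_ : ∀ {x y} → Divisible x → Divisible y → Divisible (x + y)
  _⊕_ = Divisible-+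

  ≈-by-combination : ∀ {x y e} → Integral y → x - y ≡ e → Divisible e → x ≈ y
  ≈-by-combination y-int x-y≡e e-div = ≈-fromDivisible y-int (Divisible-≡ (sym x-y≡e) e-div)

  -- If u c ≡ e (mod p) then 1/u ≡ c/e: the difference is (1/u)(1/e)(e - u c).
  recip-≈ : ∀ {u e c k} → ¬ p ∣ u → ¬ p ∣ e → Integral c → Integral k →
            ιₙ u * c ≡ ιₙ e + ιₙ p * k → recip u ≈ c * recip e
  recip-≈ {u} {e} {c} {k} p∤u p∤e c-int k-int uc≡e+pk =
    ≈-fromDivisible (Integral-* c-int (Integral-recip p∤e))
      (Divisible-≡ (sym difference) (Divisible-p* (Integral-neg (Integral-* k-int (Integral-* A-int B-int)))))
    where
    A B : ℚ
    A = recip u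
    B = recip e
    A-int : Integral A
    A-int = Integral-recip p∤u
    B-int : Integral B
    B-int = Integral-recip p∤e
    difference : A - c * B ≡ ιₙ p * (- (k * (A * B)))
    difference = begin
      A - c * B                            ≡⟨ insert-units A B c ⟩
      A * 1ℚ - c * B * 1ℚ                  ≡⟨ cong₂ (λ s t → A * s - c * B * t)
                                                       (recip-inverseˡ e {{p∤⇒nonZero p∤e}})
                                                       (recip-inverseˡ u {{p∤⇒nonZero p∤u}}) ⟨
      A * (B * ιₙ e) - c * B * (A * ιₙ u)  ≡⟨ factor A B c (ιₙ e) (ιₙ u) ⟩
      A * B * (ιₙ e - ιₙ u * c)            ≡⟨ cong (λ z → A * B * (ιₙ e - z)) uc≡e+pk ⟩
      A * B * (ιₙ e - (ιₙ e + ιₙ p * k))   ≡⟨ cancel A B (ιₙ e) (ιₙ p) k ⟩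
      ιₙ p * (- (k * (A * B)))             ∎
      where
      open ≡-Reasoning
      insert-units : ∀ A B c → A - c * B ≡ A * 1ℚ - c * B * 1ℚ
      insert-units = solve-∀ ℚ-ring
      factor : ∀ A B c E U → A * (B * E) - c * B * (A * U) ≡ A * B * (E - U * c)
      factor = solve-∀ ℚ-ring
      cancel : ∀ A B E P k → A * B * (E - (E + P * k)) ≡ P * (- (k * (A * B)))
      cancel = solve-∀ ℚ-ring

  recip-≈-cross : ∀ {u e} c k → ¬ p ∣ u → ¬ p ∣ e → u ℕ.* c ≡ e ℕ.+ p ℕ.* k →
                  recip u ≈ ιₙ c * recip e
  recip-≈-cross {u} {e} c k p∤u p∤e uc≡e+pk =
    recip-≈ p∤u p∤e (Integral-ι (+ c)) (Integral-ι (+ k)) (begin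
      ιₙ u * ιₙ c          ≡⟨ ιₙ-homo-* u c ⟨
      ιₙ (u ℕ.* c)         ≡⟨ cong ιₙ uc≡e+pk ⟩
      ιₙ (e ℕ.+ p ℕ.* k)   ≡⟨ ιₙ-homo-+ e (p ℕ.* k) ⟩
      ιₙ e + ιₙ (p ℕ.* k)  ≡⟨ cong (λ z → ιₙ e + z) (ιₙ-homo-* p k) ⟩
      ιₙ e + ιₙ p * ιₙ k   ∎)
    where open ≡-Reasoning

  recip-≈-cross-/ : ∀ {u} c e k .{{_ : ℕ.NonZero e}} → ¬ p ∣ u → ¬ p ∣ e →
                    u ℕ.* c ≡ e ℕ.+ p ℕ.* k → recip u ≈ (+ c / 1) * (+ 1 / e)
  recip-≈-cross-/ {u} c e k p∤u p∤e uc≡e+pk =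
    subst (recip u ≈_) (ιₙ-*-recip c e) (recip-≈-cross c k p∤u p∤e uc≡e+pk)

  recip-≈-reflect : ∀ {u e} c k → ¬ p ∣ u → ¬ p ∣ e → u ℕ.* c ℕ.+ e ≡ p ℕ.* k →
                    recip u ≈ - (ιₙ c * recip e)
  recip-≈-reflect {u} {e} c k p∤u p∤e uc+e≡pk =
    subst (recip u ≈_) (sym (neg-distribˡ-* (ιₙ c) (recip e)))
      (recip-≈ p∤u p∤e (Integral-neg (Integral-ι (+ c))) (Integral-neg (Integral-ι (+ k))) (begin
        ιₙ u * (- ιₙ c)               ≡⟨ move (ιₙ u) (ιₙ c) (ιₙ e) ⟩
        ιₙ e - (ιₙ u * ιₙ c + ιₙ e)   ≡⟨ cong (λ z → ιₙ e - (z + ιₙ e)) (ιₙ-homo-* u c) ⟨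
        ιₙ e - (ιₙ (u ℕ.* c) + ιₙ e)  ≡⟨ cong (λ z → ιₙ e - z) (ιₙ-homo-+ (u ℕ.* c) e) ⟨
        ιₙ e - ιₙ (u ℕ.* c ℕ.+ e)     ≡⟨ cong (λ z → ιₙ e - ιₙ z) uc+e≡pk ⟩
        ιₙ e - ιₙ (p ℕ.* k)           ≡⟨ cong (λ z → ιₙ e - z) (ιₙ-homo-* p k) ⟩
        ιₙ e - ιₙ p * ιₙ k            ≡⟨ sub-as-add (ιₙ e) (ιₙ p) (ιₙ k) ⟩
        ιₙ e + ιₙ p * (- ιₙ k)        ∎))
    where
    open ≡-Reasoning
    move : ∀ u c e → u * (- c) ≡ e - (u * c + e)
    move = solve-∀ ℚ-ring
    sub-as-add : ∀ e p k → e - p * k ≡ e + p * (- k)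
    sub-as-add = solve-∀ ℚ-ring

module Lerch (m : ℕ) (p-prime : Prime (suc m)) where

  p : ℕ
  p = suc m

  open Congruence p p-prime

  P : ℚ
  P = ιₙ p

  P*-cancel : ∀ {x y} → P * x ≡ P * y → x ≡ y
  P*-cancel {x} {y} Px≡Py = begin
    x                  ≡⟨ unit x ⟩
    recip p * P * x    ≡⟨ reassoc (recip p) P x ⟩
    recip p * (P * x)  ≡⟨ cong (recip p *_) Px≡Py ⟩
    recip p * (P * y)  ≡⟨ reassoc (recip p) P y ⟨
    recip p * P * y    ≡⟨ unit y ⟨
    y                  ∎
    where
    open ≡-Reasoning
    reassoc : ∀ a b c → a * b * c ≡ a * (b * c)
    reassoc = solve-∀ ℚ-ring
    unit : ∀ z → z ≡ recip p * P * z
    unit z = sym (trans (cong (_* z) (recip-inverseˡ p)) (*-identityˡ z))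

  ∏-1+P*-expansion : ∀ n x → (∀ i → i < n → Integral (x i)) →
                     ∃ λ E → Integral E × ∏ n (λ i → 1ℚ + P * x i) ≡ 1ℚ + P * (∑ n x + P * E)
  ∏-1+P*-expansion zero    x x-int = 0ℚ , Integral-0 , base P
    where
    base : ∀ P → 1ℚ ≡ 1ℚ + P * (0ℚ + P * 0ℚ)
    base = solve-∀ ℚ-ring
  ∏-1+P*-expansion (suc n) x x-int with ∏-1+P*-expansion n x (λ i i<n → x-int i (ℕ.m<n⇒m<1+n i<n))
  ... | E , E-int , ∏≡ =
    E + x n * (∑ n x + P * E) ,
    Integral-+ E-int (Integral-* xₙ-int (Integral-+ (Integral-∑ n (λ i i<n → x-int i (ℕ.m<n⇒m<1+n i<n)))
                                                     (Integral-* (Integral-ι (+ p)) E-int))) ,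
    trans (cong (_* (1ℚ + P * x n)) ∏≡) (step P (∑ n x) E (x n))
    where
    xₙ-int : Integral (x n)
    xₙ-int = x-int n ℕ.≤-refl
    step : ∀ P S E y → (1ℚ + P * (S + P * E)) * (1ℚ + P * y) ≡ 1ℚ + P * ((S + y) + P * (E + y * (S + P * E)))
    step = solve-∀ ℚ-ring

  a^m≥1 : ∀ {a} → ¬ p ∣ a → 1 ≤ a ℕ.^ m
  a^m≥1 {a} p∤a = ℕ.m^n>0 a {{p∤⇒nonZero p∤a}} m

  a^m≡1+P*fermatQ : ∀ {a} → ¬ p ∣ a → ιₙ (a ℕ.^ m) ≡ 1ℚ + P * fermatQ a p
  a^m≡1+P*fermatQ {a} p∤a = begin
    ιₙ (a ℕ.^ m)               ≡⟨ cong ιₙ (ℕ.m∸n+n≡m (a^m≥1 p∤a)) ⟨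
    ιₙ (a ℕ.^ m ℕ.∸ 1 ℕ.+ 1)   ≡⟨ ιₙ-homo-+ (a ℕ.^ m ℕ.∸ 1) 1 ⟩
    ιₙ (a ℕ.^ m ℕ.∸ 1) + ιₙ 1  ≡⟨ cong₂ _+_ (n/d*d≡n (+ (a ℕ.^ m ℕ.∸ 1)) p) (sym ι-1) ⟨
    fermatQ a p * P + 1ℚ       ≡⟨ flip (fermatQ a p) P ⟩
    1ℚ + P * fermatQ a p       ∎
    where
    open ≡-Reasoning
    flip : ∀ q P → q * P + 1ℚ ≡ 1ℚ + P * q
    flip = solve-∀ ℚ-ring

  fermatQ-unique : ∀ {a y} → ¬ p ∣ a → ιₙ (a ℕ.^ m) ≡ 1ℚ + P * y → fermatQ a p ≡ y
  fermatQ-unique {a} {y} p∤a a^m≡1+Py =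
    P*-cancel (+-cancelˡ (trans (sym (a^m≡1+P*fermatQ p∤a)) a^m≡1+Py))
    where
    +-cancelˡ : ∀ {u v} → 1ℚ + u ≡ 1ℚ + v → u ≡ v
    +-cancelˡ {u} {v} eq = trans (sym (cancel u)) (trans (cong (_- 1ℚ) eq) (cancel v))
      where
      cancel : ∀ u → 1ℚ + u - 1ℚ ≡ u
      cancel = solve-∀ ℚ-ring

  module _ (a : ℕ) (p∤a : ¬ p ∣ a) where

    residue quotient : ℕ → ℕ
    residue  j = (a ℕ.* j) % p
    quotient j = (a ℕ.* j) ℕ./ p

    division : ∀ j → a ℕ.* j ≡ residue j ℕ.+ p ℕ.* quotient j
    division j = trans (m≡m%n+[m/n]*n (a ℕ.* j) p) (cong (residue j ℕ.+_) (ℕ.*-comm (quotient j) p))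

    p∤a* : ∀ {j} → 0 < j → j < p → ¬ p ∣ a ℕ.* j
    p∤a* {j} 0<j j<p p∣aj with euclidsLemma a j p-prime p∣aj
    ... | inj₁ p∣a = p∤a p∣a
    ... | inj₂ p∣j = 0<j<p⇒p∤j 0<j j<p p∣j

    p∤residue : ∀ {j} → 0 < j → j < p → ¬ p ∣ residue j
    p∤residue {j} 0<j j<p p∣r =
      p∤a* 0<j j<p (subst (p ∣_) (sym (division j)) (∣m∣n⇒∣m+n p∣r (m∣m*n (quotient j))))

    residue≢0 : ∀ {j} → 0 < j → j < p → residue j ≢ 0
    residue≢0 0<j j<p r≡0 = p∤residue 0<j j<p (subst (p ∣_) (sym r≡0) (p ∣0))

    residue-injective< : ∀ {i j} → 0 < i → i < j → j < p → residue i ≢ residue j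
    residue-injective< {i} {j} 0<i i<j j<p rᵢ≡rⱼ =
      p∤a* (ℕ.m<n⇒0<n∸m i<j) (ℕ.≤-<-trans (ℕ.m∸n≤m j i) j<p) (divides (quotient j ℕ.∸ quotient i) (begin
        a ℕ.* (j ℕ.∸ i)                                          ≡⟨ ℕ.*-distribˡ-∸ a j i ⟩
        a ℕ.* j ℕ.∸ a ℕ.* i                                      ≡⟨ cong₂ ℕ._∸_ (division j) ai≡rⱼ+pqᵢ ⟩
        (rⱼ ℕ.+ p ℕ.* quotient j) ℕ.∸ (rⱼ ℕ.+ p ℕ.* quotient i)  ≡⟨ ℕ.[m+n]∸[m+o]≡n∸o rⱼ _ _ ⟩
        p ℕ.* quotient j ℕ.∸ p ℕ.* quotient i                    ≡⟨ ℕ.*-distribˡ-∸ p (quotient j) (quotient i) ⟨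
        p ℕ.* (quotient j ℕ.∸ quotient i)                        ≡⟨ ℕ.*-comm p _ ⟩
        (quotient j ℕ.∸ quotient i) ℕ.* p                        ∎))
      where
      open ≡-Reasoning
      rⱼ : ℕ
      rⱼ = residue j
      ai≡rⱼ+pqᵢ : a ℕ.* i ≡ rⱼ ℕ.+ p ℕ.* quotient i
      ai≡rⱼ+pqᵢ = trans (division i) (cong (ℕ._+ p ℕ.* quotient i) rᵢ≡rⱼ)

    σ : ℕ → ℕ
    σ i = ℕ.pred (residue (suc i))

    suc-σ : ∀ {i} → i < m → suc (σ i) ≡ residue (suc i)
    suc-σ i<m = ℕ.suc-pred _ {{ℕ.≢-nonZero (residue≢0 ℕ.z<s (ℕ.s<s i<m))}}

    σ< : ∀ {i} → i < m → σ i < m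
    σ< {i} i<m = ℕ.s<s⁻¹ (subst (_< p) (sym (suc-σ i<m)) (m%n<n (a ℕ.* suc i) p))

    σ-injective : ∀ {i j} → i < m → j < m → σ i ≡ σ j → i ≡ j
    σ-injective {i} {j} i<m j<m σi≡σj with ℕ.<-cmp i j
    ... | tri≈ _ i≡j _ = i≡j
    ... | tri< i<j _ _ = contradiction (trans (sym (suc-σ i<m)) (trans (cong suc σi≡σj) (suc-σ j<m)))
                           (residue-injective< ℕ.z<s (ℕ.s<s i<j) (ℕ.s<s j<m))
    ... | tri> _ _ j<i = contradiction (trans (sym (suc-σ j<m)) (trans (cong suc (sym σi≡σj)) (suc-σ i<m)))
                           (residue-injective< ℕ.z<s (ℕ.s<s j<i) (ℕ.s<s i<m))

    ∏-recip-residue : ∏ m (λ i → recip (residue (suc i))) ≡ ∏ m (λ i → recip (suc i))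
    ∏-recip-residue = trans (∏-cong m (λ i i<m → cong recip (sym (suc-σ i<m))))
                            (∏-permute m (λ i → recip (suc i)) σ σ< σ-injective)

    term : ℕ → ℚ
    term i = ιₙ (quotient (suc i)) * recip (residue (suc i))

    term-integral : ∀ i → i < m → Integral (term i)
    term-integral i i<m = Integral-* (Integral-ι _) (Integral-recip (p∤residue ℕ.z<s (ℕ.s<s i<m)))

    1+P*term : ∀ i → i < m → 1ℚ + P * term i ≡ ιₙ (a ℕ.* suc i) * recip (residue (suc i))
    1+P*term i i<m = begin
      1ℚ + P * term i                        ≡⟨ cong (_+ P * term i) (recip-inverseˡ r {{r≢0}}) ⟨
      recip r * ιₙ r + P * (ιₙ q * recip r)  ≡⟨ factor (recip r) (ιₙ r) P (ιₙ q) ⟩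
      (ιₙ r + P * ιₙ q) * recip r            ≡⟨ cong (λ z → (ιₙ r + z) * recip r) (ιₙ-homo-* p q) ⟨
      (ιₙ r + ιₙ (p ℕ.* q)) * recip r        ≡⟨ cong (_* recip r) (ιₙ-homo-+ r (p ℕ.* q)) ⟨
      ιₙ (r ℕ.+ p ℕ.* q) * recip r           ≡⟨ cong (λ z → ιₙ z * recip r) (division (suc i)) ⟨
      ιₙ (a ℕ.* suc i) * recip r             ∎
      where
      open ≡-Reasoning
      r q : ℕ
      r = residue (suc i)
      q = quotient (suc i)
      r≢0 : ℕ.NonZero r
      r≢0 = ℕ.≢-nonZero (residue≢0 ℕ.z<s (ℕ.s<s i<m))
      factor : ∀ R r P q → R * r + P * (q * R) ≡ (r + P * q) * R
      factor = solve-∀ ℚ-ring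

    ∏-1+P*term : ∏ m (λ i → 1ℚ + P * term i) ≡ ιₙ (a ℕ.^ m)
    ∏-1+P*term = begin
      ∏ m (λ i → 1ℚ + P * term i)                             ≡⟨ ∏-cong m 1+P*term ⟩
      ∏ m (λ i → ιₙ (a ℕ.* suc i) * recip (residue (suc i)))  ≡⟨ ∏-* m _ _ ⟩
      ∏aj * ∏ m (λ i → recip (residue (suc i)))               ≡⟨ cong (∏aj *_) ∏-recip-residue ⟩
      ∏aj * ∏ m (λ i → recip (suc i))                         ≡⟨ ∏-* m _ _ ⟨
      ∏ m (λ i → ιₙ (a ℕ.* suc i) * recip (suc i))            ≡⟨ ∏-cong m (λ i _ → cancel i) ⟩
      ∏ m (λ _ → ιₙ a)                                        ≡⟨ ∏-ιₙ-const m a ⟩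
      ιₙ (a ℕ.^ m)                                            ∎
      where
      open ≡-Reasoning
      ∏aj : ℚ
      ∏aj = ∏ m (λ i → ιₙ (a ℕ.* suc i))
      cancel : ∀ i → ιₙ (a ℕ.* suc i) * recip (suc i) ≡ ιₙ a
      cancel i = trans (cong (_* recip (suc i)) (ιₙ-homo-* a (suc i)))
        (trans (reassoc (ιₙ a) (ιₙ (suc i)) (recip (suc i)))
        (trans (cong (ιₙ a *_) (trans (*-comm (ιₙ (suc i)) (recip (suc i))) (recip-inverseˡ (suc i))))
               (*-identityʳ (ιₙ a))))
        where
        reassoc : ∀ a b c → a * b * c ≡ a * (b * c)
        reassoc = solve-∀ ℚ-ring

    fermatQ≈∑term : fermatQ a p ≈ ∑ m term
    fermatQ≈∑term = from-expansion (∏-1+P*-expansion m term term-integral)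
      where
      from-expansion : (∃ λ E → Integral E × ∏ m (λ i → 1ℚ + P * term i) ≡ 1ℚ + P * (∑ m term + P * E))
                     → fermatQ a p ≈ ∑ m term
      from-expansion (E , E-int , ∏≡) = ≈-fromDivisible (Integral-∑ m term-integral)
        (Divisible-≡ (sym (trans (cong (_- ∑ m term) q≡) (cancel (∑ m term) P E))) (Divisible-p* E-int))
        where
        q≡ : fermatQ a p ≡ ∑ m term + P * E
        q≡ = fermatQ-unique p∤a (trans (sym ∏-1+P*term) ∏≡)
        cancel : ∀ S P E → S + P * E - S ≡ P * E
        cancel = solve-∀ ℚ-ring

    term≈ : ∀ i → i < m → term i ≈ recip a * (ιₙ (quotient (suc i)) * recip (suc i))
    term≈ i i<m = subst (term i ≈_) (reorder (ιₙ (quotient (suc i))) (recip a) (recip (suc i)))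
      (≈-*ˡ (Integral-ι _) recip-residue≈)
      where
      reorder : ∀ q A J → q * (A * J) ≡ A * (q * J)
      reorder = solve-∀ ℚ-ring
      recip-residue≈ : recip (residue (suc i)) ≈ recip a * recip (suc i)
      recip-residue≈ = subst (recip (residue (suc i)) ≈_)
        (recip-homo-* a (suc i) {{p∤⇒nonZero p∤a}})
        (≈-sym (subst (recip (a ℕ.* suc i) ≈_) (trans (cong (_* recip (residue (suc i))) ι-1) (*-identityˡ _))
          (recip-≈-cross 1 (quotient (suc i)) (p∤a* ℕ.z<s (ℕ.s<s i<m)) (p∤residue ℕ.z<s (ℕ.s<s i<m))
            (trans (ℕ.*-identityʳ _) (division (suc i))))))

    lerch : fermatQ a p ≈ recip a * ∑ m (λ i → ιₙ (quotient (suc i)) * recip (suc i))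
    lerch = subst (fermatQ a p ≈_) (∑-*ˡ m (recip a) _) (≈-trans fermatQ≈∑term (≈-∑ m term≈))

  fermatQ-integral : ∀ {a} → ¬ p ∣ a → Integral (fermatQ a p)
  fermatQ-integral p∤a = proj₁ (lerch _ p∤a)

  fermatQ-homo-* : ∀ {a b} → ¬ p ∣ a → ¬ p ∣ b → fermatQ (a ℕ.* b) p ≈ fermatQ a p + fermatQ b p
  fermatQ-homo-* {a} {b} p∤a p∤b = ≈-fromDivisible (Integral-+ qa-int qb-int)
    (Divisible-≡ (sym (trans (cong (_- (qa + qb)) q≡) (cancel (qa + qb) P (qa * qb))))
                 (Divisible-p* (Integral-* qa-int qb-int)))
    where
    qa qb : ℚ
    qa = fermatQ a p
    qb = fermatQ b p
    qa-int : Integral qa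
    qa-int = fermatQ-integral p∤a
    qb-int : Integral qb
    qb-int = fermatQ-integral p∤b
    expand : ∀ P term y → (1ℚ + P * term) * (1ℚ + P * y) ≡ 1ℚ + P * (term + y + P * (term * y))
    expand = solve-∀ ℚ-ring
    cancel : ∀ S P E → S + P * E - S ≡ P * E
    cancel = solve-∀ ℚ-ring
    [ab]^m : ιₙ ((a ℕ.* b) ℕ.^ m) ≡ 1ℚ + P * (qa + qb + P * (qa * qb))
    [ab]^m = begin
      ιₙ ((a ℕ.* b) ℕ.^ m)                 ≡⟨ ∏-ιₙ-const m (a ℕ.* b) ⟨
      ∏ m (λ _ → ιₙ (a ℕ.* b))             ≡⟨ ∏-cong m (λ _ _ → ιₙ-homo-* a b) ⟩
      ∏ m (λ _ → ιₙ a * ιₙ b)              ≡⟨ ∏-* m _ _ ⟩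
      ∏ m (λ _ → ιₙ a) * ∏ m (λ _ → ιₙ b)  ≡⟨ cong₂ _*_ (∏-ιₙ-const m a) (∏-ιₙ-const m b) ⟩
      ιₙ (a ℕ.^ m) * ιₙ (b ℕ.^ m)          ≡⟨ cong₂ _*_ (a^m≡1+P*fermatQ p∤a) (a^m≡1+P*fermatQ p∤b) ⟩
      (1ℚ + P * qa) * (1ℚ + P * qb)        ≡⟨ expand P qa qb ⟩
      1ℚ + P * (qa + qb + P * (qa * qb))   ∎
      where open ≡-Reasoning
    q≡ : fermatQ (a ℕ.* b) p ≡ qa + qb + P * (qa * qb)
    q≡ = fermatQ-unique (p∤* p∤a p∤b) [ab]^m

module Harmonic (m : ℕ) (p-prime : Prime (suc m)) where

  open Lerch m p-prime using (p)
  open Congruence p p-prime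

  H : ℕ → ℕ → ℚ
  H o c = ∑ c (λ i → recip (suc (o ℕ.+ i)))

  H-+ : ∀ o c d → H o (c ℕ.+ d) ≡ H o c + H (o ℕ.+ c) d
  H-+ o c d = trans (∑-+ c d _)
    (cong (λ z → H o c + z) (∑-cong d (λ i _ → cong (recip ∘ suc) (sym (ℕ.+-assoc o c i)))))

  H-suc : ∀ o c → H o (suc c) ≡ recip (suc o) + H (suc o) c
  H-suc o c = trans (∑-suc c _)
    (cong₂ _+_ (cong (recip ∘ suc) (ℕ.+-identityʳ o)) (∑-cong c (λ i _ → cong (recip ∘ suc) (ℕ.+-suc o i))))

  -- Reflecting j ↦ p - j turns the progression u, u + d, …, u + d (c - 1) into d (M + c), …, d (M + 1).
  progression-reflect : ∀ d .{{_ : ℕ.NonZero d}} u M c → 0 < u → u ℕ.+ d ℕ.* (M ℕ.+ c) ≡ p →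
                        ∑ c (λ k → recip (u ℕ.+ d ℕ.* k)) ≈ - (recip d * H M c)
  progression-reflect d u M zero    0<u _ =
    ≈-reflexive (0≡-[x*0] (recip d)) Integral-0
    where
    0≡-[x*0] : ∀ x → 0ℚ ≡ - (x * 0ℚ)
    0≡-[x*0] = solve-∀ ℚ-ring
  progression-reflect d u M (suc c) 0<u u+d[M+1+c]≡p =
    subst (∑ (suc c) (λ k → recip (u ℕ.+ d ℕ.* k)) ≈_) (sym combine)
      (≈-+ (progression-reflect d u (suc M) c 0<u
              (trans (cong (λ z → u ℕ.+ d ℕ.* z) (sym (ℕ.+-suc M c))) u+d[M+1+c]≡p))
           last≈)
    where
    uc : ℕ
    uc = u ℕ.+ d ℕ.* c
    uc+d[M+1]≡p : uc ℕ.+ d ℕ.* suc M ≡ p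
    uc+d[M+1]≡p = trans (regroup u d c M) u+d[M+1+c]≡p
      where
      regroup : ∀ u d c M → u ℕ.+ d ℕ.* c ℕ.+ d ℕ.* suc M ≡ u ℕ.+ d ℕ.* (M ℕ.+ suc c)
      regroup = ℕ-Solver.solve-∀
    0<d[M+1] : 0 < d ℕ.* suc M
    0<d[M+1] = ℕ.>-nonZero⁻¹ (d ℕ.* suc M) {{ℕ.m*n≢0 d (suc M)}}
    last≈ : recip uc ≈ - (recip d * recip (suc M))
    last≈ = subst (λ z → recip uc ≈ - z)
      (trans (cong (_* recip (d ℕ.* suc M)) ι-1) (trans (*-identityˡ _) (recip-homo-* d (suc M))))
      (recip-≈-reflect 1 1
        (x+y≡p⇒p∤x uc+d[M+1]≡p (ℕ.<-≤-trans 0<u (ℕ.m≤m+n u _)) 0<d[M+1])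
        (x+y≡p⇒p∤x (trans (ℕ.+-comm _ uc) uc+d[M+1]≡p) 0<d[M+1] (ℕ.<-≤-trans 0<u (ℕ.m≤m+n u _)))
        (trans (cong (ℕ._+ d ℕ.* suc M) (ℕ.*-identityʳ uc)) (trans uc+d[M+1]≡p (sym (ℕ.*-identityʳ p)))))
    combine : - (recip d * H M (suc c)) ≡ - (recip d * H (suc M) c) + - (recip d * recip (suc M))
    combine = trans (cong (λ z → - (recip d * z)) (H-suc M c)) (distrib (recip d) (recip (suc M)) (H (suc M) c))
      where
      distrib : ∀ x a b → - (x * (a + b)) ≡ - (x * b) + - (x * a)
      distrib = solve-∀ ℚ-ring

  H-reflect : ∀ o c M → o ℕ.+ c ℕ.+ M ≡ m → H o c ≈ - H M c
  H-reflect o c M o+c+M≡m =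
    subst₂ _≈_ (∑-cong c (λ i _ → cong recip (cong suc (cong (o ℕ.+_) (ℕ.*-identityˡ i)))))
               (cong -_ (trans (cong (_* H M c) (recip-literal 1)) (*-identityˡ (H M c))))
      (progression-reflect 1 (suc o) M c ℕ.z<s (trans (regroup o c M) (cong suc o+c+M≡m)))
    where
    regroup : ∀ o c M → suc o ℕ.+ 1 ℕ.* (M ℕ.+ c) ≡ suc (o ℕ.+ c ℕ.+ M)
    regroup = ℕ-Solver.solve-∀

  H-split-mod3 : ∀ c → H 0 (3 ℕ.* c) ≡
    ∑ c (λ k → recip (1 ℕ.+ 3 ℕ.* k)) + ∑ c (λ k → recip (2 ℕ.+ 3 ℕ.* k)) + recip 3 * H 0 c
  H-split-mod3 zero    = 0≡0+0+x*0 (recip 3)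
    where
    0≡0+0+x*0 : ∀ x → 0ℚ ≡ 0ℚ + 0ℚ + x * 0ℚ
    0≡0+0+x*0 = solve-∀ ℚ-ring
  H-split-mod3 (suc c) = begin
    H 0 (3 ℕ.* suc c)                                     ≡⟨ cong (H 0) (3[1+c] c) ⟩
    H 0 (3 ℕ.* c ℕ.+ 3)                                   ≡⟨ H-+ 0 (3 ℕ.* c) 3 ⟩
    H 0 (3 ℕ.* c) + H (3 ℕ.* c) 3                         ≡⟨ cong₂ _+_ (H-split-mod3 c) last-three ⟩
    (A + B + r₃ * C) + (0ℚ + a + b + r₃ * recip (suc c))  ≡⟨ regroup A B C r₃ a b (recip (suc c)) ⟩
    (A + a) + (B + b) + r₃ * (C + recip (suc c))          ∎
    where
    open ≡-Reasoning
    A B C a b r₃ : ℚ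
    A = ∑ c (λ k → recip (1 ℕ.+ 3 ℕ.* k))
    B = ∑ c (λ k → recip (2 ℕ.+ 3 ℕ.* k))
    C = H 0 c
    a = recip (1 ℕ.+ 3 ℕ.* c)
    b = recip (2 ℕ.+ 3 ℕ.* c)
    r₃ = recip 3
    3[1+c] : ∀ c → 3 ℕ.* suc c ≡ 3 ℕ.* c ℕ.+ 3
    3[1+c] = ℕ-Solver.solve-∀
    1+3c : ∀ c → suc (3 ℕ.* c ℕ.+ 0) ≡ 1 ℕ.+ 3 ℕ.* c
    1+3c = ℕ-Solver.solve-∀
    2+3c : ∀ c → suc (3 ℕ.* c ℕ.+ 1) ≡ 2 ℕ.+ 3 ℕ.* c
    2+3c = ℕ-Solver.solve-∀
    3[1+c]′ : ∀ c → suc (3 ℕ.* c ℕ.+ 2) ≡ 3 ℕ.* suc c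
    3[1+c]′ = ℕ-Solver.solve-∀
    last-three : H (3 ℕ.* c) 3 ≡ 0ℚ + a + b + r₃ * recip (suc c)
    last-three = cong₂ _+_ (cong₂ (λ x y → 0ℚ + x + y) (cong recip (1+3c c)) (cong recip (2+3c c)))
                           (trans (cong recip (3[1+c]′ c)) (recip-homo-* 3 (suc c)))
    regroup : ∀ A B C r a b w → (A + B + r * C) + (0ℚ + a + b + r * w) ≡ (A + a) + (B + b) + r * (C + w)
    regroup = solve-∀ ℚ-ring

module Sextant (m : ℕ) (p-prime : Prime (suc m)) where

  open Lerch m p-prime using (p; lerch; fermatQ-homo-*)
  open Congruence p p-prime
  open Harmonic m p-prime using (H; H-reflect)

  /-unique : ∀ x K → K ℕ.* p ≤ x → x < K ℕ.* p ℕ.+ p → x ℕ./ p ≡ K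
  /-unique x K Kp≤x x<Kp+p = begin
    x ℕ./ p                                  ≡⟨ /-congˡ (sym (ℕ.m∸n+n≡m Kp≤x)) ⟩
    (x ℕ.∸ K ℕ.* p ℕ.+ K ℕ.* p) ℕ./ p        ≡⟨ +-distrib-/-∣ʳ (x ℕ.∸ K ℕ.* p) (n∣m*n K) ⟩
    (x ℕ.∸ K ℕ.* p) ℕ./ p ℕ.+ K ℕ.* p ℕ./ p  ≡⟨ cong₂ ℕ._+_ (m<n⇒m/n≡0 x-Kp<p) (m*n/n≡m K p) ⟩
    K                                        ∎
    where
    open ≡-Reasoning
    x-Kp<p : x ℕ.∸ K ℕ.* p < p
    x-Kp<p = ℕ.+-cancelˡ-< (K ℕ.* p) _ _ (subst (_< K ℕ.* p ℕ.+ p) (sym (ℕ.m+[n∸m]≡n Kp≤x)) x<Kp+p)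

  /-nested : ∀ a d j .{{_ : ℕ.NonZero d}} → d ℕ.* a ≡ 6 → (a ℕ.* j) ℕ./ p ≡ (6 ℕ.* j) ℕ./ p ℕ./ d
  /-nested a d j da≡6 = sym (begin
    (6 ℕ.* j) ℕ./ p ℕ./ d            ≡⟨ cong (λ z → z ℕ./ p ℕ./ d) 6j≡d[aj] ⟩
    (d ℕ.* (a ℕ.* j)) ℕ./ p ℕ./ d    ≡⟨ m/n/o≡m/[n*o] (d ℕ.* (a ℕ.* j)) p d ⟩
    (d ℕ.* (a ℕ.* j)) ℕ./ (p ℕ.* d)  ≡⟨ cong (λ z → z ℕ./ (p ℕ.* d)) (ℕ.*-comm d (a ℕ.* j)) ⟩
    (a ℕ.* j ℕ.* d) ℕ./ (p ℕ.* d)    ≡⟨ m*n/o*n≡m/o (a ℕ.* j) d p ⟩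
    (a ℕ.* j) ℕ./ p                  ∎)
    where
    open ≡-Reasoning
    6j≡d[aj] : 6 ℕ.* j ≡ d ℕ.* (a ℕ.* j)
    6j≡d[aj] = trans (cong (ℕ._* j) (sym da≡6)) (ℕ.*-assoc d a j)
    instance
      pd≢0 : ℕ.NonZero (p ℕ.* d)
      pd≢0 = ℕ.m*n≢0 p d

  ∑-sextants-⌊s/3⌋ : ∀ (b : ℕ → ℚ) → ∑ 6 (λ s → (+ (s ℕ./ 3) / 1) * b s) ≡ b 3 + b 4 + b 5
  ∑-sextants-⌊s/3⌋ b = expand (b 0) (b 1) (b 2) (b 3) (b 4) (b 5)
    where
    expand : ∀ b₀ b₁ b₂ b₃ b₄ b₅ →
      0ℚ + (+ 0 / 1) * b₀ + (+ 0 / 1) * b₁ + (+ 0 / 1) * b₂ + (+ 1 / 1) * b₃ + (+ 1 / 1) * b₄ + (+ 1 / 1) * b₅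
        ≡ b₃ + b₄ + b₅
    expand = solve-∀ ℚ-ring

  ∑-sextants-⌊s/2⌋ : ∀ (b : ℕ → ℚ) →
                     ∑ 6 (λ s → (+ (s ℕ./ 2) / 1) * b s) ≡ b 2 + b 3 + (+ 2 / 1) * (b 4 + b 5)
  ∑-sextants-⌊s/2⌋ b = expand (b 0) (b 1) (b 2) (b 3) (b 4) (b 5)
    where
    expand : ∀ b₀ b₁ b₂ b₃ b₄ b₅ →
      0ℚ + (+ 0 / 1) * b₀ + (+ 0 / 1) * b₁ + (+ 1 / 1) * b₂ + (+ 1 / 1) * b₃ + (+ 2 / 1) * b₄ + (+ 2 / 1) * b₅
        ≡ b₂ + b₃ + (+ 2 / 1) * (b₄ + b₅)
    expand = solve-∀ ℚ-ring

  ∑-sextants-s : ∀ (b : ℕ → ℚ) → ∑ 6 (λ s → (+ (s ℕ./ 1) / 1) * b s) ≡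
                 b 1 + (+ 2 / 1) * b 2 + (+ 3 / 1) * b 3 + (+ 4 / 1) * b 4 + (+ 5 / 1) * b 5
  ∑-sextants-s b = expand (b 0) (b 1) (b 2) (b 3) (b 4) (b 5)
    where
    expand : ∀ b₀ b₁ b₂ b₃ b₄ b₅ →
      0ℚ + (+ 0 / 1) * b₀ + (+ 1 / 1) * b₁ + (+ 2 / 1) * b₂ + (+ 3 / 1) * b₃ + (+ 4 / 1) * b₄ + (+ 5 / 1) * b₅
        ≡ b₁ + (+ 2 / 1) * b₂ + (+ 3 / 1) * b₃ + (+ 4 / 1) * b₄ + (+ 5 / 1) * b₅
    expand = solve-∀ ℚ-ring

  -- A partition of 1, …, p - 1 into six consecutive blocks with ⌊6 j / p⌋ = s on block s;
  -- j ↦ p - j maps block s onto block 5 - s.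
  record Sextants : Set where
    field
      length        : ℕ → ℕ
      covers        : offset length 6 ≡ m
      starts-above  : ∀ s → s < 6 → s ℕ.* p ≤ 6 ℕ.* suc (offset length s)
      ends-below    : ∀ s → s < 6 → 6 ℕ.* (offset length s ℕ.+ length s) < s ℕ.* p ℕ.+ p
      mirror        : ∀ s → s < 3 → offset length s ℕ.+ length s ℕ.+ offset length (5 ℕ.∸ s) ≡ m
      mirror-length : ∀ s → s < 3 → length (5 ℕ.∸ s) ≡ length s

    block : ℕ → ℚ
    block s = H (offset length s) (length s)

    sextant : ∀ {s i} → s < 6 → i < length s → (6 ℕ.* suc (offset length s ℕ.+ i)) ℕ./ p ≡ s
    sextant {s} {i} s<6 i<ℓ = /-unique _ s
      (ℕ.≤-trans (starts-above s s<6) (ℕ.*-monoʳ-≤ 6 (ℕ.s≤s (ℕ.m≤m+n _ i))))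
      (ℕ.≤-<-trans (ℕ.*-monoʳ-≤ 6 (subst (_≤ offset length s ℕ.+ length s) (ℕ.+-suc _ i)
                                                (ℕ.+-monoʳ-≤ _ i<ℓ)))
                   (ends-below s s<6))

    lerch-sextants : ∀ a d .{{_ : ℕ.NonZero a}} .{{_ : ℕ.NonZero d}} → d ℕ.* a ≡ 6 → ¬ p ∣ a →
                     fermatQ a p ≈ (+ 1 / a) * ∑ 6 (λ s → (+ (s ℕ./ d) / 1) * block s)
    lerch-sextants a d da≡6 p∤a = subst (fermatQ a p ≈_) (cong₂ _*_ (recip-literal a) regroup) (lerch a p∤a)
      where
      o : ℕ → ℕ
      o = offset length
      g : ℕ → ℚ
      g i = ιₙ ((a ℕ.* suc i) ℕ./ p) * recip (suc i)
      floor-on-block : ∀ {s i} → s < 6 → i < length s → (a ℕ.* suc (o s ℕ.+ i)) ℕ./ p ≡ s ℕ./ d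
      floor-on-block s<6 i<ℓ = trans (/-nested a d _ da≡6) (cong (ℕ._/ d) (sextant s<6 i<ℓ))
      blockwise : ∀ s → s < 6 → ∑ (length s) (λ i → g (o s ℕ.+ i)) ≡ (+ (s ℕ./ d) / 1) * block s
      blockwise s s<6 = begin
        ∑ (length s) (λ i → g (o s ℕ.+ i))
          ≡⟨ ∑-cong (length s) (λ i i<ℓ → cong (λ z → ιₙ z * recip (suc (o s ℕ.+ i))) (floor-on-block s<6 i<ℓ)) ⟩
        ∑ (length s) (λ i → ιₙ (s ℕ./ d) * recip (suc (o s ℕ.+ i)))  ≡⟨ ∑-*ˡ (length s) (ιₙ (s ℕ./ d)) _ ⟩
        ιₙ (s ℕ./ d) * block s                                       ≡⟨ cong (_* block s) (ι-literal (+ (s ℕ./ d))) ⟩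
        (+ (s ℕ./ d) / 1) * block s                                  ∎
        where open ≡-Reasoning
      regroup : ∑ m g ≡ ∑ 6 (λ s → (+ (s ℕ./ d) / 1) * block s)
      regroup = begin
        ∑ m g                                           ≡⟨ cong (λ n → ∑ n g) covers ⟨
        ∑ (o 6) g                                       ≡⟨ ∑-blocks length 6 g ⟩
        ∑ 6 (λ s → ∑ (length s) (λ i → g (o s ℕ.+ i)))  ≡⟨ ∑-cong 6 blockwise ⟩
        ∑ 6 (λ s → (+ (s ℕ./ d) / 1) * block s)         ∎
        where open ≡-Reasoning

    block-reflect : ∀ s → s < 3 → block s ≈ - block (5 ℕ.∸ s)
    block-reflect s s<3 =
      subst (λ c → block s ≈ - H (offset length (5 ℕ.∸ s)) c) (sym (mirror-length s s<3))
        (H-reflect (offset length s) (length s) (offset length (5 ℕ.∸ s)) (mirror s s<3))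

  module Sextant-sums (S : Sextants) (p∤2 : ¬ p ∣ 2) (p∤3 : ¬ p ∣ 3) where
    open Sextants S using (block; block-reflect; lerch-sextants)

    q₂ q₃ q₆ b₀ b₁ b₂ b₃ b₄ b₅ : ℚ
    q₂ = fermatQ 2 p
    q₃ = fermatQ 3 p
    q₆ = fermatQ 6 p
    b₀ = block 0
    b₁ = block 1
    b₂ = block 2
    b₃ = block 3
    b₄ = block 4
    b₅ = block 5

    over-1 : ∀ n → Integral (n / 1)
    over-1 n = Integral-/ n 1 p∤1

    over-2 : ∀ n → Integral (n / 2)
    over-2 n = Integral-/ n 2 p∤2

    lerch₂ : q₂ ≈ (+ 1 / 2) * (b₃ + b₄ + b₅)
    lerch₂ = subst (λ z → q₂ ≈ (+ 1 / 2) * z) (∑-sextants-⌊s/3⌋ block) (lerch-sextants 2 3 refl p∤2)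

    lerch₃ : q₃ ≈ (+ 1 / 3) * (b₂ + b₃ + (+ 2 / 1) * (b₄ + b₅))
    lerch₃ = subst (λ z → q₃ ≈ (+ 1 / 3) * z) (∑-sextants-⌊s/2⌋ block) (lerch-sextants 3 2 refl p∤3)

    lerch₆ : q₆ ≈ (+ 1 / 6) * (b₁ + (+ 2 / 1) * b₂ + (+ 3 / 1) * b₃ + (+ 4 / 1) * b₄ + (+ 5 / 1) * b₅)
    lerch₆ = subst (λ z → q₆ ≈ (+ 1 / 6) * z) (∑-sextants-s block) (lerch-sextants 6 1 refl (p∤* p∤2 p∤3))

    q₆≈q₂+q₃ : q₆ ≈ q₂ + q₃
    q₆≈q₂+q₃ = fermatQ-homo-* p∤2 p∤3

    reflect₀ : b₀ ≈ - b₅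
    reflect₀ = block-reflect 0 ℕ.z<s

    reflect₁ : b₁ ≈ - b₄
    reflect₁ = block-reflect 1 (ℕ.s<s ℕ.z<s)

    reflect₂ : b₂ ≈ - b₃
    reflect₂ = block-reflect 2 (ℕ.s<s (ℕ.s<s ℕ.z<s))

    2q₂-integral : Integral ((+ 2 / 1) * q₂)
    2q₂-integral = Integral-* (over-1 (+ 2)) (proj₁ lerch₂)

    3q₃/2-integral : Integral ((+ 3 / 2) * q₃)
    3q₃/2-integral = Integral-* (over-2 (+ 3)) (proj₁ lerch₃)

    block₀≈ : b₀ ≈ - ((+ 2 / 1) * q₂ + (+ 3 / 2) * q₃)
    block₀≈ = ≈-by-combination
      (Integral-neg (Integral-+ 2q₂-integral 3q₃/2-integral))
      (certificate b₀ b₁ b₂ b₃ b₄ b₅ q₂ q₃ q₆)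
      (over-1 (+ 1) ⊙ reflect₀ ⊕ over-2 (+ 1) ⊙ reflect₁ ⊕ over-2 (+ 1) ⊙ reflect₂
         ⊕ over-1 (ℤ.- + 1) ⊙ lerch₂ ⊕ over-2 (ℤ.- + 3) ⊙ lerch₃ ⊕ over-1 (+ 3) ⊙ lerch₆
         ⊕ over-1 (ℤ.- + 3) ⊙ q₆≈q₂+q₃)
      where
      certificate : ∀ b₀ b₁ b₂ b₃ b₄ b₅ q₂ q₃ q₆ →
        b₀ - - ((+ 2 / 1) * q₂ + (+ 3 / 2) * q₃) ≡
          (+ 1 / 1) * (b₀ - - b₅) + (+ 1 / 2) * (b₁ - - b₄) + (+ 1 / 2) * (b₂ - - b₃)
          + (ℤ.- + 1 / 1) * (q₂ - (+ 1 / 2) * (b₃ + b₄ + b₅))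
          + (ℤ.- + 3 / 2) * (q₃ - (+ 1 / 3) * (b₂ + b₃ + (+ 2 / 1) * (b₄ + b₅)))
          + (+ 3 / 1) * (q₆ - (+ 1 / 6) * (b₁ + (+ 2 / 1) * b₂ + (+ 3 / 1) * b₃ + (+ 4 / 1) * b₄ + (+ 5 / 1) * b₅))
          + (ℤ.- + 3 / 1) * (q₆ - (q₂ + q₃))
      certificate = solve-∀ ℚ-ring

    block₁≈ : b₁ ≈ (+ 2 / 1) * q₂
    block₁≈ = ≈-by-combination 2q₂-integral
      (certificate b₁ b₂ b₃ b₄ b₅ q₂ q₃ q₆)
      (over-2 (+ 1) ⊙ reflect₁ ⊕ over-1 (+ 1) ⊙ lerch₂ ⊕ over-1 (+ 3) ⊙ lerch₃
         ⊕ over-1 (ℤ.- + 3) ⊙ lerch₆ ⊕ over-1 (+ 3) ⊙ q₆≈q₂+q₃)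
      where
      certificate : ∀ b₁ b₂ b₃ b₄ b₅ q₂ q₃ q₆ →
        b₁ - (+ 2 / 1) * q₂ ≡
          (+ 1 / 2) * (b₁ - - b₄)
          + (+ 1 / 1) * (q₂ - (+ 1 / 2) * (b₃ + b₄ + b₅))
          + (+ 3 / 1) * (q₃ - (+ 1 / 3) * (b₂ + b₃ + (+ 2 / 1) * (b₄ + b₅)))
          + (ℤ.- + 3 / 1) * (q₆ - (+ 1 / 6) * (b₁ + (+ 2 / 1) * b₂ + (+ 3 / 1) * b₃ + (+ 4 / 1) * b₄ + (+ 5 / 1) * b₅))
          + (+ 3 / 1) * (q₆ - (q₂ + q₃))
      certificate = solve-∀ ℚ-ring

    block₂≈ : b₂ ≈ (+ 3 / 2) * q₃ - (+ 2 / 1) * q₂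
    block₂≈ = ≈-by-combination
      (Integral-+ 3q₃/2-integral (Integral-neg 2q₂-integral))
      (certificate b₂ b₃ b₄ b₅ q₂ q₃)
      (over-2 (+ 1) ⊙ reflect₂ ⊕ over-1 (+ 2) ⊙ lerch₂ ⊕ over-2 (ℤ.- + 3) ⊙ lerch₃)
      where
      certificate : ∀ b₂ b₃ b₄ b₅ q₂ q₃ →
        b₂ - ((+ 3 / 2) * q₃ - (+ 2 / 1) * q₂) ≡
          (+ 1 / 2) * (b₂ - - b₃)
          + (+ 2 / 1) * (q₂ - (+ 1 / 2) * (b₃ + b₄ + b₅))
          + (ℤ.- + 3 / 2) * (q₃ - (+ 1 / 3) * (b₂ + b₃ + (+ 2 / 1) * (b₄ + b₅)))
      certificate = solve-∀ ℚ-ring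

module One-mod-6 (n : ℕ) (p-prime : Prime (suc (6 ℕ.* suc n))) where

  open Lerch (6 ℕ.* suc n) p-prime using (p)
  open Congruence p p-prime
  open Harmonic (6 ℕ.* suc n) p-prime using (H; H-+; H-suc; H-split-mod3; progression-reflect)
  open Sextant (6 ℕ.* suc n) p-prime

  N : ℕ
  N = suc n

  sextants : Sextants
  sextants = record
    { length        = λ _ → N
    ; covers        = offset-const N 6
    ; starts-above  = λ s s<6 → subst (λ o → s ℕ.* p ≤ 6 ℕ.* suc o) (sym (offset-const N s))
                                  (starts-above s s<6)
    ; ends-below    = λ s _ → subst (λ o → 6 ℕ.* (o ℕ.+ N) < s ℕ.* p ℕ.+ p) (sym (offset-const N s))
                                (ends-below s)
    ; mirror        = mirror
    ; mirror-length = λ _ _ → refl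
    }
    where
    starts-above : ∀ s → s < 6 → s ℕ.* p ≤ 6 ℕ.* suc (s ℕ.* N)
    starts-above s s<6 = subst₂ _≤_ (sym (left s N)) (sym (right s N)) (ℕ.+-monoˡ-≤ (6 ℕ.* (s ℕ.* N)) (ℕ.<⇒≤ s<6))
      where
      left : ∀ s N → s ℕ.* suc (6 ℕ.* N) ≡ s ℕ.+ 6 ℕ.* (s ℕ.* N)
      left = ℕ-Solver.solve-∀
      right : ∀ s N → 6 ℕ.* suc (s ℕ.* N) ≡ 6 ℕ.+ 6 ℕ.* (s ℕ.* N)
      right = ℕ-Solver.solve-∀
    ends-below : ∀ s → 6 ℕ.* (s ℕ.* N ℕ.+ N) < s ℕ.* p ℕ.+ p
    ends-below s = <-witness s (gap s N)
      where
      gap : ∀ s N → suc (6 ℕ.* (s ℕ.* N ℕ.+ N) ℕ.+ s) ≡ s ℕ.* suc (6 ℕ.* N) ℕ.+ suc (6 ℕ.* N)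
      gap = ℕ-Solver.solve-∀
    mirror : ∀ s → s < 3 → offset (λ _ → N) s ℕ.+ N ℕ.+ offset (λ _ → N) (5 ℕ.∸ s) ≡ 6 ℕ.* N
    mirror = <3-cases (sum₀ N) (sum₁ N) (sum₂ N)
      where
      sum₀ : ∀ N → 0 ℕ.+ N ℕ.+ (0 ℕ.+ N ℕ.+ N ℕ.+ N ℕ.+ N ℕ.+ N) ≡ 6 ℕ.* N
      sum₀ = ℕ-Solver.solve-∀
      sum₁ : ∀ N → 0 ℕ.+ N ℕ.+ N ℕ.+ (0 ℕ.+ N ℕ.+ N ℕ.+ N ℕ.+ N) ≡ 6 ℕ.* N
      sum₁ = ℕ-Solver.solve-∀
      sum₂ : ∀ N → 0 ℕ.+ N ℕ.+ N ℕ.+ N ℕ.+ (0 ℕ.+ N ℕ.+ N ℕ.+ N) ≡ 6 ℕ.* N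
      sum₂ = ℕ-Solver.solve-∀

  open Sextants sextants using (block)

  p∤2 : ¬ p ∣ 2
  p∤2 = x+y≡p⇒p∤x (sum n) ℕ.z<s ℕ.z<s
    where
    sum : ∀ n → 2 ℕ.+ (5 ℕ.+ 6 ℕ.* n) ≡ suc (6 ℕ.* suc n)
    sum = ℕ-Solver.solve-∀

  p∤3 : ¬ p ∣ 3
  p∤3 = x+y≡p⇒p∤x (sum n) ℕ.z<s ℕ.z<s
    where
    sum : ∀ n → 3 ℕ.+ (4 ℕ.+ 6 ℕ.* n) ≡ suc (6 ℕ.* suc n)
    sum = ℕ-Solver.solve-∀

  p∤5 : ¬ p ∣ 5
  p∤5 = x+y≡p⇒p∤x (sum n) ℕ.z<s ℕ.z<s
    where
    sum : ∀ n → 5 ℕ.+ (2 ℕ.+ 6 ℕ.* n) ≡ suc (6 ℕ.* suc n)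
    sum = ℕ-Solver.solve-∀

  open Sextant-sums sextants p∤2 p∤3 using (q₂; q₃; block₀≈; block₁≈; block₂≈)

  -- 6 N ≡ -1, 2 (3 N + 1) ≡ 1, 2 (3 N + 2) ≡ 3, 2 (3 N + 3) ≡ 5 and 6 (N + 1) ≡ 5 (mod p).

  recip-N≈ : recip N ≈ - (+ 6 / 1)
  recip-N≈ = subst (λ z → recip N ≈ - z) (ιₙ-*-recip 6 1)
    (recip-≈-reflect 6 1 (x+y≡p⇒p∤x (sum n) ℕ.z<s ℕ.z<s) p∤1 (eq n))
    where
    sum : ∀ n → suc n ℕ.+ suc (5 ℕ.* suc n) ≡ suc (6 ℕ.* suc n)
    sum = ℕ-Solver.solve-∀
    eq : ∀ n → suc n ℕ.* 6 ℕ.+ 1 ≡ suc (6 ℕ.* suc n) ℕ.* 1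
    eq = ℕ-Solver.solve-∀

  x₁ x₂ x₃ y : ℚ
  x₁ = recip (suc (N ℕ.+ N ℕ.+ N ℕ.+ 0))
  x₂ = recip (suc (N ℕ.+ N ℕ.+ N ℕ.+ 1))
  x₃ = recip (suc (N ℕ.+ N ℕ.+ N ℕ.+ 2))
  y  = recip (suc (N ℕ.+ 0))

  x₁≈ : x₁ ≈ + 2 / 1
  x₁≈ = recip-≈-cross-/ 2 1 1 (x+y≡p⇒p∤x (sum n) ℕ.z<s ℕ.z<s) p∤1 (eq n)
    where
    sum : ∀ n → suc (suc n ℕ.+ suc n ℕ.+ suc n ℕ.+ 0) ℕ.+ suc (3 ℕ.* n ℕ.+ 2) ≡ suc (6 ℕ.* suc n)
    sum = ℕ-Solver.solve-∀
    eq : ∀ n → suc (suc n ℕ.+ suc n ℕ.+ suc n ℕ.+ 0) ℕ.* 2 ≡ 1 ℕ.+ suc (6 ℕ.* suc n) ℕ.* 1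
    eq = ℕ-Solver.solve-∀

  x₂≈ : x₂ ≈ + 2 / 3
  x₂≈ = recip-≈-cross-/ 2 3 1 (x+y≡p⇒p∤x (sum n) ℕ.z<s ℕ.z<s) p∤3 (eq n)
    where
    sum : ∀ n → suc (suc n ℕ.+ suc n ℕ.+ suc n ℕ.+ 1) ℕ.+ suc (3 ℕ.* n ℕ.+ 1) ≡ suc (6 ℕ.* suc n)
    sum = ℕ-Solver.solve-∀
    eq : ∀ n → suc (suc n ℕ.+ suc n ℕ.+ suc n ℕ.+ 1) ℕ.* 2 ≡ 3 ℕ.+ suc (6 ℕ.* suc n) ℕ.* 1
    eq = ℕ-Solver.solve-∀

  x₃≈ : x₃ ≈ + 2 / 5
  x₃≈ = recip-≈-cross-/ 2 5 1 (x+y≡p⇒p∤x (sum n) ℕ.z<s ℕ.z<s) p∤5 (eq n)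
    where
    sum : ∀ n → suc (suc n ℕ.+ suc n ℕ.+ suc n ℕ.+ 2) ℕ.+ suc (3 ℕ.* n) ≡ suc (6 ℕ.* suc n)
    sum = ℕ-Solver.solve-∀
    eq : ∀ n → suc (suc n ℕ.+ suc n ℕ.+ suc n ℕ.+ 2) ℕ.* 2 ≡ 5 ℕ.+ suc (6 ℕ.* suc n) ℕ.* 1
    eq = ℕ-Solver.solve-∀

  y≈ : y ≈ + 6 / 5
  y≈ = recip-≈-cross-/ 6 5 1 (x+y≡p⇒p∤x (sum n) ℕ.z<s ℕ.z<s) p∤5 (eq n)
    where
    sum : ∀ n → suc (suc n ℕ.+ 0) ℕ.+ suc (5 ℕ.* n ℕ.+ 4) ≡ suc (6 ℕ.* suc n)
    sum = ℕ-Solver.solve-∀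
    eq : ∀ n → suc (suc n ℕ.+ 0) ℕ.* 6 ≡ 5 ℕ.+ suc (6 ℕ.* suc n) ℕ.* 1
    eq = ℕ-Solver.solve-∀

  T₁ T₂ : ℚ
  T₁ = ∑ (suc N) (λ k → recip (1 ℕ.+ 3 ℕ.* k))
  T₂ = ∑ (suc N) (λ k → recip (2 ℕ.+ 3 ℕ.* k))

  T₁≈ : T₁ ≈ (- (+ 2 / 3)) * q₂ + + 2 / 1
  T₁≈ = begin
    T₁                                            ≈⟨ progression-reflect 3 1 n (suc N) ℕ.z<s (sum n) ⟩
    - (recip 3 * H n (suc N))                     ≡⟨ cong (λ z → - (recip 3 * z)) (H-suc n N) ⟩
    - (recip 3 * (recip N + block 1))             ≈⟨ ≈-neg (≈-* (recip≈/ 3 p∤3) (≈-+ recip-N≈ block₁≈)) ⟩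
    - (+ 1 / 3 * (- (+ 6 / 1) + (+ 2 / 1) * q₂))  ≡⟨ simplify q₂ ⟩
    (- (+ 2 / 3)) * q₂ + + 2 / 1                  ∎
    where
    open ≈-Reasoning
    sum : ∀ n → 1 ℕ.+ 3 ℕ.* (n ℕ.+ suc (suc n)) ≡ suc (6 ℕ.* suc n)
    sum = ℕ-Solver.solve-∀
    simplify : ∀ q → - (+ 1 / 3 * (- (+ 6 / 1) + (+ 2 / 1) * q)) ≡ (- (+ 2 / 3)) * q + + 2 / 1
    simplify = solve-∀ ℚ-ring

  T₂≡ : T₂ ≡ (block 0 + block 1 + block 2 + (0ℚ + x₁ + x₂ + x₃)) - T₁ - recip 3 * (block 0 + (0ℚ + y))
  T₂≡ = trans (isolate T₁ T₂ (recip 3) (H 0 (suc N)))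
    (cong₂ (λ A C → A - T₁ - recip 3 * C) (trans (sym (H-split-mod3 (suc N))) first-half) first-sixth)
    where
    isolate : ∀ T₁ T₂ r C → T₂ ≡ (T₁ + T₂ + r * C) - T₁ - r * C
    isolate = solve-∀ ℚ-ring
    first-half : H 0 (3 ℕ.* suc N) ≡ block 0 + block 1 + block 2 + (0ℚ + x₁ + x₂ + x₃)
    first-half = begin
      H 0 (3 ℕ.* suc N)                                  ≡⟨ cong (H 0) (split N) ⟩
      H 0 (3N ℕ.+ 3)                                     ≡⟨ H-+ 0 3N 3 ⟩
      H 0 3N + H 3N 3                                    ≡⟨ cong (_+ H 3N 3) (H-+ 0 (N ℕ.+ N) N) ⟩
      H 0 (N ℕ.+ N) + block 2 + H 3N 3                   ≡⟨ cong (λ z → z + block 2 + H 3N 3) (H-+ 0 N N) ⟩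
      block 0 + block 1 + block 2 + (0ℚ + x₁ + x₂ + x₃)  ∎
      where
      open ≡-Reasoning
      3N : ℕ
      3N = N ℕ.+ N ℕ.+ N
      split : ∀ N → 3 ℕ.* suc N ≡ N ℕ.+ N ℕ.+ N ℕ.+ 3
      split = ℕ-Solver.solve-∀
    first-sixth : H 0 (suc N) ≡ block 0 + (0ℚ + y)
    first-sixth = trans (cong (H 0) (ℕ.+-comm 1 N)) (H-+ 0 N 1)

  T₂≈ : T₂ ≈ (- (+ 2 / 3)) * q₂ + (+ 1 / 2) * q₃ + + 2 / 3
  T₂≈ = begin
    T₂  ≡⟨ T₂≡ ⟩
    (block 0 + block 1 + block 2 + (0ℚ + x₁ + x₂ + x₃)) - T₁ - recip 3 * (block 0 + (0ℚ + y))
      ≈⟨ ≈-- (≈-- (≈-+ first-half≈ extras≈) T₁≈) (≈-* (recip≈/ 3 p∤3) first-sixth≈) ⟩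
    (b₀ + b₁ + b₂ + (0ℚ + + 2 / 1 + + 2 / 3 + + 2 / 5)) - t₁ - + 1 / 3 * (b₀ + (0ℚ + + 6 / 5))
                                                                               ≡⟨ simplify q₂ q₃ ⟩
    (- (+ 2 / 3)) * q₂ + (+ 1 / 2) * q₃ + + 2 / 3  ∎
    where
    open ≈-Reasoning
    b₀ b₁ b₂ t₁ : ℚ
    b₀ = - ((+ 2 / 1) * q₂ + (+ 3 / 2) * q₃)
    b₁ = (+ 2 / 1) * q₂
    b₂ = (+ 3 / 2) * q₃ - (+ 2 / 1) * q₂
    t₁ = (- (+ 2 / 3)) * q₂ + + 2 / 1
    first-half≈ : block 0 + block 1 + block 2 ≈ b₀ + b₁ + b₂
    first-half≈ = ≈-+ (≈-+ block₀≈ block₁≈) block₂≈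
    extras≈ : 0ℚ + x₁ + x₂ + x₃ ≈ 0ℚ + + 2 / 1 + + 2 / 3 + + 2 / 5
    extras≈ = ≈-+ (≈-+ (≈-+ (≈-refl Integral-0) x₁≈) x₂≈) x₃≈
    first-sixth≈ : block 0 + (0ℚ + y) ≈ b₀ + (0ℚ + + 6 / 5)
    first-sixth≈ = ≈-+ block₀≈ (≈-+ (≈-refl Integral-0) y≈)
    simplify : ∀ q₂ q₃ →
      (- ((+ 2 / 1) * q₂ + (+ 3 / 2) * q₃) + (+ 2 / 1) * q₂ + ((+ 3 / 2) * q₃ - (+ 2 / 1) * q₂)
        + (0ℚ + + 2 / 1 + + 2 / 3 + + 2 / 5))
      - ((- (+ 2 / 3)) * q₂ + + 2 / 1)
      - + 1 / 3 * (- ((+ 2 / 1) * q₂ + (+ 3 / 2) * q₃) + (0ℚ + + 6 / 5))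
      ≡ (- (+ 2 / 3)) * q₂ + (+ 1 / 2) * q₃ + + 2 / 3
    simplify = solve-∀ ℚ-ring

module Five-mod-6 (n : ℕ) (p-prime : Prime (suc (4 ℕ.+ 6 ℕ.* n))) where

  open Lerch (4 ℕ.+ 6 ℕ.* n) p-prime using (p)
  open Congruence p p-prime
  open Harmonic (4 ℕ.+ 6 ℕ.* n) p-prime using (H; H-+; H-split-mod3; progression-reflect)
  open Sextant (4 ℕ.+ 6 ℕ.* n) p-prime

  length : ℕ → ℕ
  length 0 = n
  length 5 = n
  length _ = suc n

  covers : offset length 6 ≡ 4 ℕ.+ 6 ℕ.* n
  covers = sum n
    where
    sum : ∀ n → 0 ℕ.+ n ℕ.+ suc n ℕ.+ suc n ℕ.+ suc n ℕ.+ suc n ℕ.+ n ≡ 4 ℕ.+ 6 ℕ.* n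
    sum = ℕ-Solver.solve-∀

  starts-above : ∀ s → s < 6 → s ℕ.* p ≤ 6 ℕ.* suc (offset length s)
  starts-above = <6-cases
    ℕ.z≤n (≤-witness 1 (bound₁ n)) (≤-witness 2 (bound₂ n))
    (≤-witness 3 (bound₃ n)) (≤-witness 4 (bound₄ n)) (≤-witness 5 (bound₅ n))
    where
    bound₁ : ∀ n → 1 ℕ.* suc (4 ℕ.+ 6 ℕ.* n) ℕ.+ 1 ≡ 6 ℕ.* suc (0 ℕ.+ n)
    bound₁ = ℕ-Solver.solve-∀
    bound₂ : ∀ n → 2 ℕ.* suc (4 ℕ.+ 6 ℕ.* n) ℕ.+ 2 ≡ 6 ℕ.* suc (0 ℕ.+ n ℕ.+ suc n)
    bound₂ = ℕ-Solver.solve-∀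
    bound₃ : ∀ n → 3 ℕ.* suc (4 ℕ.+ 6 ℕ.* n) ℕ.+ 3 ≡ 6 ℕ.* suc (0 ℕ.+ n ℕ.+ suc n ℕ.+ suc n)
    bound₃ = ℕ-Solver.solve-∀
    bound₄ : ∀ n → 4 ℕ.* suc (4 ℕ.+ 6 ℕ.* n) ℕ.+ 4 ≡ 6 ℕ.* suc (0 ℕ.+ n ℕ.+ suc n ℕ.+ suc n ℕ.+ suc n)
    bound₄ = ℕ-Solver.solve-∀
    bound₅ : ∀ n → 5 ℕ.* suc (4 ℕ.+ 6 ℕ.* n) ℕ.+ 5 ≡ 6 ℕ.* suc (0 ℕ.+ n ℕ.+ suc n ℕ.+ suc n ℕ.+ suc n ℕ.+ suc n)
    bound₅ = ℕ-Solver.solve-∀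

  ends-below : ∀ s → s < 6 → 6 ℕ.* (offset length s ℕ.+ length s) < s ℕ.* p ℕ.+ p
  ends-below = <6-cases
    (<-witness 4 (bound₀ n)) (<-witness 3 (bound₁ n)) (<-witness 2 (bound₂ n))
    (<-witness 1 (bound₃ n)) (<-witness 0 (bound₄ n)) (<-witness 5 (bound₅ n))
    where
    bound₀ : ∀ n → suc (6 ℕ.* (0 ℕ.+ n) ℕ.+ 4)
                 ≡ 0 ℕ.* suc (4 ℕ.+ 6 ℕ.* n) ℕ.+ suc (4 ℕ.+ 6 ℕ.* n)
    bound₀ = ℕ-Solver.solve-∀
    bound₁ : ∀ n → suc (6 ℕ.* (0 ℕ.+ n ℕ.+ suc n) ℕ.+ 3)
                 ≡ 1 ℕ.* suc (4 ℕ.+ 6 ℕ.* n) ℕ.+ suc (4 ℕ.+ 6 ℕ.* n)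
    bound₁ = ℕ-Solver.solve-∀
    bound₂ : ∀ n → suc (6 ℕ.* (0 ℕ.+ n ℕ.+ suc n ℕ.+ suc n) ℕ.+ 2)
                 ≡ 2 ℕ.* suc (4 ℕ.+ 6 ℕ.* n) ℕ.+ suc (4 ℕ.+ 6 ℕ.* n)
    bound₂ = ℕ-Solver.solve-∀
    bound₃ : ∀ n → suc (6 ℕ.* (0 ℕ.+ n ℕ.+ suc n ℕ.+ suc n ℕ.+ suc n) ℕ.+ 1)
                 ≡ 3 ℕ.* suc (4 ℕ.+ 6 ℕ.* n) ℕ.+ suc (4 ℕ.+ 6 ℕ.* n)
    bound₃ = ℕ-Solver.solve-∀
    bound₄ : ∀ n → suc (6 ℕ.* (0 ℕ.+ n ℕ.+ suc n ℕ.+ suc n ℕ.+ suc n ℕ.+ suc n) ℕ.+ 0)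
                 ≡ 4 ℕ.* suc (4 ℕ.+ 6 ℕ.* n) ℕ.+ suc (4 ℕ.+ 6 ℕ.* n)
    bound₄ = ℕ-Solver.solve-∀
    bound₅ : ∀ n → suc (6 ℕ.* (0 ℕ.+ n ℕ.+ suc n ℕ.+ suc n ℕ.+ suc n ℕ.+ suc n ℕ.+ n) ℕ.+ 5)
                 ≡ 5 ℕ.* suc (4 ℕ.+ 6 ℕ.* n) ℕ.+ suc (4 ℕ.+ 6 ℕ.* n)
    bound₅ = ℕ-Solver.solve-∀

  mirror : ∀ s → s < 3 → offset length s ℕ.+ length s ℕ.+ offset length (5 ℕ.∸ s) ≡ 4 ℕ.+ 6 ℕ.* n
  mirror = <3-cases (sum₀ n) (sum₁ n) (sum₂ n)
    where
    sum₀ : ∀ n → 0 ℕ.+ n ℕ.+ (0 ℕ.+ n ℕ.+ suc n ℕ.+ suc n ℕ.+ suc n ℕ.+ suc n) ≡ 4 ℕ.+ 6 ℕ.* n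
    sum₀ = ℕ-Solver.solve-∀
    sum₁ : ∀ n → 0 ℕ.+ n ℕ.+ suc n ℕ.+ (0 ℕ.+ n ℕ.+ suc n ℕ.+ suc n ℕ.+ suc n) ≡ 4 ℕ.+ 6 ℕ.* n
    sum₁ = ℕ-Solver.solve-∀
    sum₂ : ∀ n → 0 ℕ.+ n ℕ.+ suc n ℕ.+ suc n ℕ.+ (0 ℕ.+ n ℕ.+ suc n ℕ.+ suc n) ≡ 4 ℕ.+ 6 ℕ.* n
    sum₂ = ℕ-Solver.solve-∀

  sextants : Sextants
  sextants = record
    { length        = length
    ; covers        = covers
    ; starts-above  = starts-above
    ; ends-below    = ends-below
    ; mirror        = mirror
    ; mirror-length = <3-cases refl refl refl
    }

  open Sextants sextants using (block)

  p∤2 : ¬ p ∣ 2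
  p∤2 = x+y≡p⇒p∤x (sum n) ℕ.z<s ℕ.z<s
    where
    sum : ∀ n → 2 ℕ.+ (3 ℕ.+ 6 ℕ.* n) ≡ suc (4 ℕ.+ 6 ℕ.* n)
    sum = ℕ-Solver.solve-∀

  p∤3 : ¬ p ∣ 3
  p∤3 = x+y≡p⇒p∤x (sum n) ℕ.z<s ℕ.z<s
    where
    sum : ∀ n → 3 ℕ.+ (2 ℕ.+ 6 ℕ.* n) ≡ suc (4 ℕ.+ 6 ℕ.* n)
    sum = ℕ-Solver.solve-∀

  open Sextant-sums sextants p∤2 p∤3 using (q₂; q₃; block₀≈; block₁≈; block₂≈)

  -- 2 (3 n + 3) ≡ 1 and 6 (n + 1) ≡ 1 (mod p).

  x y : ℚ
  x = recip (suc (n ℕ.+ suc n ℕ.+ suc n ℕ.+ 0))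
  y = recip (suc (n ℕ.+ 0))

  x≈ : x ≈ + 2 / 1
  x≈ = recip-≈-cross-/ 2 1 1 (x+y≡p⇒p∤x (sum n) ℕ.z<s ℕ.z<s) p∤1 (eq n)
    where
    sum : ∀ n → suc (n ℕ.+ suc n ℕ.+ suc n ℕ.+ 0) ℕ.+ suc (3 ℕ.* n ℕ.+ 1) ≡ suc (4 ℕ.+ 6 ℕ.* n)
    sum = ℕ-Solver.solve-∀
    eq : ∀ n → suc (n ℕ.+ suc n ℕ.+ suc n ℕ.+ 0) ℕ.* 2 ≡ 1 ℕ.+ suc (4 ℕ.+ 6 ℕ.* n) ℕ.* 1
    eq = ℕ-Solver.solve-∀

  y≈ : y ≈ + 6 / 1
  y≈ = recip-≈-cross-/ 6 1 1 (x+y≡p⇒p∤x (sum n) ℕ.z<s ℕ.z<s) p∤1 (eq n)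
    where
    sum : ∀ n → suc (n ℕ.+ 0) ℕ.+ suc (5 ℕ.* n ℕ.+ 3) ≡ suc (4 ℕ.+ 6 ℕ.* n)
    sum = ℕ-Solver.solve-∀
    eq : ∀ n → suc (n ℕ.+ 0) ℕ.* 6 ≡ 1 ℕ.+ suc (4 ℕ.+ 6 ℕ.* n) ℕ.* 1
    eq = ℕ-Solver.solve-∀

  T₁ T₂ : ℚ
  T₁ = ∑ (suc n) (λ k → recip (1 ℕ.+ 3 ℕ.* k))
  T₂ = ∑ (suc n) (λ k → recip (2 ℕ.+ 3 ℕ.* k))

  T₂≈ : T₂ ≈ (- (+ 2 / 3)) * q₂
  T₂≈ = begin
    T₂                              ≈⟨ progression-reflect 3 2 n (suc n) ℕ.z<s (sum n) ⟩
    - (recip 3 * block 1)           ≈⟨ ≈-neg (≈-* (recip≈/ 3 p∤3) block₁≈) ⟩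
    - (+ 1 / 3 * ((+ 2 / 1) * q₂))  ≡⟨ simplify q₂ ⟩
    (- (+ 2 / 3)) * q₂              ∎
    where
    open ≈-Reasoning
    sum : ∀ n → 2 ℕ.+ 3 ℕ.* (n ℕ.+ suc n) ≡ suc (4 ℕ.+ 6 ℕ.* n)
    sum = ℕ-Solver.solve-∀
    simplify : ∀ q → - (+ 1 / 3 * ((+ 2 / 1) * q)) ≡ (- (+ 2 / 3)) * q
    simplify = solve-∀ ℚ-ring

  T₁≡ : T₁ ≡ (block 0 + block 1 + block 2 + (0ℚ + x)) - T₂ - recip 3 * (block 0 + (0ℚ + y))
  T₁≡ = trans (isolate T₁ T₂ (recip 3) (H 0 (suc n)))
    (cong₂ (λ A C → A - T₂ - recip 3 * C) (trans (sym (H-split-mod3 (suc n))) first-half) first-sixth)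
    where
    isolate : ∀ T₁ T₂ r C → T₁ ≡ (T₁ + T₂ + r * C) - T₂ - r * C
    isolate = solve-∀ ℚ-ring
    first-half : H 0 (3 ℕ.* suc n) ≡ block 0 + block 1 + block 2 + (0ℚ + x)
    first-half = begin
      H 0 (3 ℕ.* suc n)                       ≡⟨ cong (H 0) (split n) ⟩
      H 0 (3n+2 ℕ.+ 1)                        ≡⟨ H-+ 0 3n+2 1 ⟩
      H 0 3n+2 + H 3n+2 1                     ≡⟨ cong (_+ H 3n+2 1) (H-+ 0 (n ℕ.+ suc n) (suc n)) ⟩
      H 0 (n ℕ.+ suc n) + block 2 + H 3n+2 1  ≡⟨ cong (λ z → z + block 2 + H 3n+2 1) (H-+ 0 n (suc n)) ⟩
      block 0 + block 1 + block 2 + (0ℚ + x)  ∎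
      where
      open ≡-Reasoning
      3n+2 : ℕ
      3n+2 = n ℕ.+ suc n ℕ.+ suc n
      split : ∀ n → 3 ℕ.* suc n ≡ n ℕ.+ suc n ℕ.+ suc n ℕ.+ 1
      split = ℕ-Solver.solve-∀
    first-sixth : H 0 (suc n) ≡ block 0 + (0ℚ + y)
    first-sixth = trans (cong (H 0) (ℕ.+-comm 1 n)) (H-+ 0 n 1)

  T₁≈ : T₁ ≈ (+ 1 / 2) * q₃ + (- (+ 2 / 3)) * q₂
  T₁≈ = begin
    T₁  ≡⟨ T₁≡ ⟩
    (block 0 + block 1 + block 2 + (0ℚ + x)) - T₂ - recip 3 * (block 0 + (0ℚ + y))
      ≈⟨ ≈-- (≈-- (≈-+ first-half≈ extra≈) T₂≈) (≈-* (recip≈/ 3 p∤3) first-sixth≈) ⟩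
    (b₀ + b₁ + b₂ + (0ℚ + + 2 / 1)) - t₂ - + 1 / 3 * (b₀ + (0ℚ + + 6 / 1))
                                                                           ≡⟨ simplify q₂ q₃ ⟩
    (+ 1 / 2) * q₃ + (- (+ 2 / 3)) * q₂  ∎
    where
    open ≈-Reasoning
    b₀ b₁ b₂ t₂ : ℚ
    b₀ = - ((+ 2 / 1) * q₂ + (+ 3 / 2) * q₃)
    b₁ = (+ 2 / 1) * q₂
    b₂ = (+ 3 / 2) * q₃ - (+ 2 / 1) * q₂
    t₂ = (- (+ 2 / 3)) * q₂
    first-half≈ : block 0 + block 1 + block 2 ≈ b₀ + b₁ + b₂
    first-half≈ = ≈-+ (≈-+ block₀≈ block₁≈) block₂≈
    extra≈ : 0ℚ + x ≈ 0ℚ + + 2 / 1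
    extra≈ = ≈-+ (≈-refl Integral-0) x≈
    first-sixth≈ : block 0 + (0ℚ + y) ≈ b₀ + (0ℚ + + 6 / 1)
    first-sixth≈ = ≈-+ block₀≈ (≈-+ (≈-refl Integral-0) y≈)
    simplify : ∀ q₂ q₃ →
      (- ((+ 2 / 1) * q₂ + (+ 3 / 2) * q₃) + (+ 2 / 1) * q₂ + ((+ 3 / 2) * q₃ - (+ 2 / 1) * q₂) + (0ℚ + + 2 / 1))
      - (- (+ 2 / 3)) * q₂
      - + 1 / 3 * (- ((+ 2 / 1) * q₂ + (+ 3 / 2) * q₃) + (0ℚ + + 6 / 1))
      ≡ (+ 1 / 2) * q₃ + (- (+ 2 / 3)) * q₂
    simplify = solve-∀ ℚ-ring

sumTo≡∑ : ∀ n f → sumTo n f ≡ ∑ (suc n) f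
sumTo≡∑ zero    f = sym (+-identityˡ (f 0))
sumTo≡∑ (suc n) f = cong (_+ f (suc n)) (sumTo≡∑ n f)

sumTo-recip : ∀ r K → sumTo K (λ k → (+ 1) / (suc r ℕ.+ 3 ℕ.* k)) ≡
                          ∑ (suc K) (λ k → recip (suc r ℕ.+ 3 ℕ.* k))
sumTo-recip r K = trans (sumTo≡∑ K _) (∑-cong (suc K) (λ k _ → sym (recip-literal (suc r ℕ.+ 3 ℕ.* k))))

Congruences≡1 : ℕ → ℕ → Set
Congruences≡1 K p =
  (sumTo K (λ k → (+ 1) / (1 ℕ.+ 3 ℕ.* k))
     ≡ (- ((+ 2) / 3)) * fermatQ 2 p + (+ 2) / 1 [modℚ p ])
  × (sumTo K (λ k → (+ 1) / (2 ℕ.+ 3 ℕ.* k))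
     ≡ (- ((+ 2) / 3)) * fermatQ 2 p + ((+ 1) / 2) * fermatQ 3 p + (+ 2) / 3 [modℚ p ])

Congruences≡5 : ℕ → ℕ → Set
Congruences≡5 K p =
  (sumTo K (λ k → (+ 1) / (1 ℕ.+ 3 ℕ.* k))
     ≡ ((+ 1) / 2) * fermatQ 3 p + (- ((+ 2) / 3)) * fermatQ 2 p [modℚ p ])
  × (sumTo K (λ k → (+ 1) / (2 ℕ.+ 3 ℕ.* k))
     ≡ (- ((+ 2) / 3)) * fermatQ 2 p [modℚ p ])

≡1-mod-6 : ∀ p → Prime p → p % 6 ≡ 1 → ∃ λ n → p ≡ suc (6 ℕ.* suc n)
≡1-mod-6 p p-prime p%6≡1 =
  shape (p ℕ./ 6) (trans (m≡m%n+[m/n]*n p 6) (cong (ℕ._+ p ℕ./ 6 ℕ.* 6) p%6≡1))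
  where
  shape : ∀ q → p ≡ 1 ℕ.+ q ℕ.* 6 → ∃ λ n → p ≡ suc (6 ℕ.* suc n)
  shape zero    p≡1 = contradiction p≡1 (ℕ.nonTrivial⇒≢1 {{prime⇒nonTrivial p-prime}})
  shape (suc n) eq  = n , trans eq (regroup n)
    where
    regroup : ∀ n → 1 ℕ.+ suc n ℕ.* 6 ≡ suc (6 ℕ.* suc n)
    regroup = ℕ-Solver.solve-∀

≡5-mod-6 : ∀ p → p % 6 ≡ 5 → ∃ λ n → p ≡ suc (4 ℕ.+ 6 ℕ.* n)
≡5-mod-6 p p%6≡5 =
  p ℕ./ 6 , trans (m≡m%n+[m/n]*n p 6) (trans (cong (ℕ._+ p ℕ./ 6 ℕ.* 6) p%6≡5) (regroup (p ℕ./ 6)))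
  where
  regroup : ∀ n → 5 ℕ.+ n ℕ.* 6 ≡ suc (4 ℕ.+ 6 ℕ.* n)
  regroup = ℕ-Solver.solve-∀

6n/6≡n : ∀ n → 6 ℕ.* n ℕ./ 6 ≡ n
6n/6≡n n = trans (cong (ℕ._/ 6) (ℕ.*-comm 6 n)) (m*n/n≡m n 6)

case-one : ∀ p → Prime p → p % 6 ≡ 1 → Congruences≡1 ((p ∸ 1) ℕ./ 6) p
case-one p p-prime p%6≡1 with ≡1-mod-6 p p-prime p%6≡1
... | n , refl = subst (λ K → Congruences≡1 K p) (sym (6n/6≡n (suc n)))
  ( ≈⇒≡[modℚ] (≈-respˡ-≡ (sumTo-recip 0 (suc n)) T₁≈)
  , ≈⇒≡[modℚ] (≈-respˡ-≡ (sumTo-recip 1 (suc n)) T₂≈) )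
  where
  open One-mod-6 n p-prime using (T₁≈; T₂≈)
  open Congruence p p-prime using (≈⇒≡[modℚ]; ≈-respˡ-≡)

case-five : ∀ p → Prime p → p % 6 ≡ 5 → Congruences≡5 ((p ∸ 5) ℕ./ 6) p
case-five p p-prime p%6≡5 with ≡5-mod-6 p p%6≡5
... | n , refl = subst (λ K → Congruences≡5 K p) (sym (6n/6≡n n))
  ( ≈⇒≡[modℚ] (≈-respˡ-≡ (sumTo-recip 0 n) T₁≈)
  , ≈⇒≡[modℚ] (≈-respˡ-≡ (sumTo-recip 1 n) T₂≈) )
  where
  open Five-mod-6 n p-prime using (T₁≈; T₂≈)
  open Congruence p p-prime using (≈⇒≡[modℚ]; ≈-respˡ-≡)

lemma5 : (p : ℕ) → Prime p →
    (p % 6 ≡ 1 →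
      (sumTo ((p ∸ 1) Data.Nat./ 6) (λ k → (+ 1) / (1 Data.Nat.+ 3 Data.Nat.* k))
         ≡ (- ((+ 2) / 3)) * fermatQ 2 p + (+ 2) / 1 [modℚ p ])
      × (sumTo ((p ∸ 1) Data.Nat./ 6) (λ k → (+ 1) / (2 Data.Nat.+ 3 Data.Nat.* k))
         ≡ (- ((+ 2) / 3)) * fermatQ 2 p + ((+ 1) / 2) * fermatQ 3 p + (+ 2) / 3 [modℚ p ]))
    × (p % 6 ≡ 5 →
      (sumTo ((p ∸ 5) Data.Nat./ 6) (λ k → (+ 1) / (1 Data.Nat.+ 3 Data.Nat.* k))
         ≡ ((+ 1) / 2) * fermatQ 3 p + (- ((+ 2) / 3)) * fermatQ 2 p [modℚ p ])
      × (sumTo ((p ∸ 5) Data.Nat./ 6) (λ k → (+ 1) / (2 Data.Nat.+ 3 Data.Nat.* k))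
         ≡ (- ((+ 2) / 3)) * fermatQ 2 p [modℚ p ]))
lemma5 p p-prime = case-one p p-prime , case-five p p-prime
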